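{- Let $n=2k+1$ be odd with $k\ge1$, let $a\in\mathbb{F}_{2^n}^*$, and let $h(x)=x+a^{ -1}\mathrm{Tr}(a^3x^3)$. Let $\{a^{ -1},\omega_1,\dots,\omega_{n-1}\}$ be a basis of $\mathbb{F}_{2^n}$ over $\mathbb{F}_2$, and define $F_h:\mathbb{F}_2^{n-1}\to\mathbb{F}_2$ by letting $F_h(x_1,\dots,x_{n-1})$ be the coefficient of $a^{ -1}$ when $h\big(\sum_{i=1}^{n-1}x_i\omega_i\big)$ is written in this basis (so that the image of $h$ equals $\{F_h(x_1,\dots,x_{n-1})a^{ -1}+\sum_{i}x_i\omega_i : x_i\in\mathbb{F}_2\}$). Then $F_h$ is a bent function in $n-1$ variables, and it is affine equivalent to $x_1x_2\oplus x_3x_4\oplus\cdots\oplus x_{n-2}x_{n-1}\oplus\epsilon$ for some $\epsilon\in\mathbb{F}_2$.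
   Context: $\mathrm{Tr}$ denotes the absolute trace from $\mathbb{F}_{2^n}$ to $\mathbb{F}_2$. For even $r$, a Boolean function $F:\mathbb{F}_2^r\to\mathbb{F}_2$ is bent if its Hamming distance to every affine Boolean function equals $2^{r-1}\pm2^{r/2-1}$. Two Boolean functions $F,G$ on $\mathbb{F}_2^r$ are affine equivalent if $G(x)=F(Ax+b)$ for some invertible $r\times r$ matrix $A$ over $\mathbb{F}_2$ and some $b\in\mathbb{F}_2^r$. -}

module Defs where

open import Data.Nat using (ℕ; zero; suc; _^_; _∸_; ⌊_/2⌋) renaming (_+_ to _+ℕ_)
open import Data.Bool using (Bool; true; false; _∧_; _xor_; if_then_else_)
open import Data.Fin using (Fin; zero; suc; _≟_)
open import Data.Vec using (Vec; []; _∷_; lookup; tabulate; zipWith)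
open import Data.List using (List; []; _∷_; _++_; map; length; filter)
open import Data.Product using (Σ; ∃; _×_; _,_)
open import Data.Sum using (_⊎_)
open import Relation.Binary.PropositionalEquality using (_≡_; _≢_)
open import Relation.Nullary.Decidable using (isYes)
open import Algebra.Structures using (IsCommutativeRing)
open import Function.Bundles using (_↔_)
open import Function.Definitions using (Bijective)

-- The finite field F_{2^n}, given abstractly: a field of characteristic 2
-- (negation is the identity) with exactly 2^n elements.

record GF2^ (n : ℕ) : Set₁ where
  infixl 6 _+_
  infixl 7 _*_
  field
    K       : Set
    _+_ _*_ : K → K → K
    0# 1#   : K
    _⁻¹     : K → K
    isCommutativeRing : IsCommutativeRing _≡_ _+_ _*_ (λ x → x) 0# 1#
    0≢1     : 0# ≢ 1#
    inverse : ∀ x → x ≢ 0# → x * (x ⁻¹) ≡ 1#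
    card    : Fin (2 ^ n) ↔ K

  pow : K → ℕ → K
  pow x zero    = 1#
  pow x (suc m) = x * pow x m

  sumK : ℕ → (ℕ → K) → K
  sumK zero    f = 0#
  sumK (suc m) f = sumK m f + f m

  -- absolute trace F_{2^n} → F_2 (as an element of the prime subfield)
  Tr : K → K
  Tr x = sumK n (λ i → pow x (2 ^ i))

  scal : Bool → K → K
  scal b x = if b then x else 0#

  lincomb : ∀ {m} → Vec Bool m → Vec K m → K
  lincomb []       []       = 0#
  lincomb (c ∷ cs) (b ∷ bs) = scal c b + lincomb cs bs

  IsBasis : ∀ {m} → Vec K m → Set
  IsBasis bs = Bijective _≡_ _≡_ (λ c → lincomb c bs)

BoolFun : ℕ → Set
BoolFun r = Vec Bool r → Bool

allVecs : ∀ r → List (Vec Bool r)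
allVecs zero    = [] ∷ []
allVecs (suc r) = map (false ∷_) (allVecs r) ++ map (true ∷_) (allVecs r)

xorSum : ∀ {m} → (Fin m → Bool) → Bool
xorSum {zero}  f = false
xorSum {suc m} f = f zero xor xorSum (λ i → f (suc i))

dot : ∀ {r} → Vec Bool r → Vec Bool r → Bool
dot u x = xorSum (λ i → lookup u i ∧ lookup x i)

affineFun : ∀ {r} → Vec Bool r → Bool → BoolFun r
affineFun u c x = dot u x xor c

dist : ∀ {r} → BoolFun r → BoolFun r → ℕ
dist {r} F G = length (filter (λ x → (F x xor G x) Data.Bool.≟ true) (allVecs r))

IsBent : ∀ r → BoolFun r → Set
IsBent r F = ∀ (u : Vec Bool r) (c : Bool) →
  (dist F (affineFun u c) ≡ 2 ^ (r ∸ 1) +ℕ 2 ^ (⌊ r /2⌋ ∸ 1))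
  ⊎ (dist F (affineFun u c) +ℕ 2 ^ (⌊ r /2⌋ ∸ 1) ≡ 2 ^ (r ∸ 1))

Mat : ℕ → Set
Mat r = Fin r → Fin r → Bool

_·M_ : ∀ {r} → Mat r → Mat r → Mat r
(A ·M B) i j = xorSum (λ l → A i l ∧ B l j)

idM : ∀ {r} → Mat r
idM i j = isYes (i ≟ j)

Invertible : ∀ {r} → Mat r → Set
Invertible A = ∃ λ B → (∀ i j → (A ·M B) i j ≡ idM i j) × (∀ i j → (B ·M A) i j ≡ idM i j)

applyM : ∀ {r} → Mat r → Vec Bool r → Vec Bool r
applyM A x = tabulate (λ i → xorSum (λ j → A i j ∧ lookup x j))

AffineEquivalent : ∀ {r} → BoolFun r → BoolFun r → Set
AffineEquivalent {r} F G =
  Σ (Mat r) λ A → Σ (Vec Bool r) λ b →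
    Invertible A × (∀ x → G x ≡ F (zipWith _xor_ (applyM A x) b))

pairsQF : ∀ {r} → Vec Bool r → Bool
pairsQF []            = false
pairsQF (x ∷ [])      = false
pairsQF (x ∷ y ∷ xs)  = (x ∧ y) xor pairsQF xs

-- Put U x = a · Σ xᵢωᵢ.  Since Tr takes values in 𝔽₂ and a⁻¹, ω is a basis, the hypothesis says
-- exactly that F_h(x) = Tr((U x)³).  Hence F_h is a quadratic function whose polar form is
-- B(U x, U y) with B(u, v) = Tr(u v²) + Tr(u² v).  If B(u, ·) = 0 then Tr((u + u⁴) w²) = 0 for
-- all w; since squaring is onto and Tr 1 = 1 (n is odd) this gives u⁴ = u, so u² = u (n is odd
-- again) and u ∈ 𝔽₂.  But U x ∈ 𝔽₂ = {0, a · a⁻¹} only for x = 0, because a⁻¹ ∉ span ω.  So F_h is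
-- a nondegenerate quadratic function on 𝔽₂ⁿ⁻¹.  Splitting off hyperbolic planes one at a time
-- (Dickson) brings it, by a linear change of coordinates, to x₁x₂ ⊕ ⋯ ⊕ x_{n-2}x_{n-1} plus an
-- affine function; completing the square turns the linear part into a translation.  Finally
-- x₁x₂ ⊕ ⋯ is bent by a direct count, and bentness survives linear changes of coordinates and
-- the addition of affine functions.

module Submission where

open import Defs
open import Data.Nat as N using (ℕ; _≤_)
open import Data.Bool using (Bool; _xor_)
open import Data.Vec using (Vec; _∷_)
open import Data.Product using (Σ; ∃; _×_)
open import Relation.Binary.PropositionalEquality using (_≡_; _≢_)

open import Data.Nat using (zero; suc; _^_; ⌊_/2⌋)
import Data.Nat.Properties as N
open import Data.Nat.ListAction using (sum)
open import Data.Nat.ListAction.Properties using (sum-++; sum-↭)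
open import Data.Nat.Tactic.RingSolver using (solve-∀)
open import Data.Bool using (true; false; not; _∧_; if_then_else_)
open import Data.Bool.Properties as Bool
  using (xor-assoc; xor-comm; xor-same; xor-identityˡ; xor-identityʳ; ∧-identityʳ; ∧-zeroʳ)
open import Data.Bool.Solver using (module xor-∧-Solver)
open import Data.Fin using (Fin; zero; suc; punchIn)
import Data.Fin.Properties as Fin
open import Data.Fin.Permutation using (Permutation; permutation)
open import Data.Vec using ([]; replicate; zipWith; lookup; tabulate; head; tail)
open import Data.Vec.Properties
  using (zipWith-assoc; zipWith-comm; zipWith-identityˡ; zipWith-identityʳ;
         lookup∘tabulate; lookup-zipWith; lookup-replicate; tabulate∘lookup; tabulate-cong)
open import Data.List using (List; []; _∷_; map; _++_; length; filter)
open import Data.List.Properties using (map-++; map-∘; map-cong; length-++; length-map)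
open import Data.List.Membership.Propositional using (_∈_)
open import Data.List.Membership.Propositional.Properties using (∈-map⁺; ∈-map⁻; ∈-++⁺ˡ; ∈-++⁺ʳ)
open import Data.List.Membership.Propositional.Properties.WithK using (unique∧set⇒bag)
open import Data.List.Relation.Unary.Any as Any using (here; any?; satisfied)
import Data.List.Relation.Unary.All as All
import Data.List.Relation.Unary.AllPairs as AllPairs
open import Data.List.Relation.Unary.Unique.Propositional using (Unique)
import Data.List.Relation.Unary.Unique.Propositional.Properties as Unique
open import Data.List.Relation.Binary.Permutation.Propositional using (_↭_; ↭-sym)
import Data.List.Relation.Binary.Permutation.Propositional.Properties as ↭
open import Data.List.Relation.Binary.BagAndSetEquality using (∼bag⇒↭)
open import Data.Maybe using (Maybe)
import Data.Maybe as Maybe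
open import Data.Product using (∃₂; _,_; proj₁; proj₂)
open import Data.Sum using (_⊎_; inj₁; inj₂)
open import Data.Empty using (⊥-elim)
open import Algebra.Bundles using (CommutativeRing; CommutativeMonoid)
open import Algebra.Structures using (IsCommutativeRing)
open import Algebra.Solver.Ring.AlmostCommutativeRing using (fromCommutativeRing; _-Raw-AlmostCommutative⟶_)
import Algebra.Solver.Ring
import Algebra.Properties.CommutativeMonoid.Sum as ProductProperties
open import Function using (_∘_; id; mk⇔)
open import Function.Bundles using (Inverse; _↔_)
open import Relation.Nullary using (¬_; Dec; yes; no)
open import Relation.Nullary.Decidable using (dec⇒maybe)
open import Relation.Binary.PropositionalEquality using (refl; sym; trans; cong; cong₂; subst; module ≡-Reasoning)

private variable
  X : Set
  m r : ℕ

xor-cancelʳ : ∀ a b → (a xor b) xor b ≡ a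
xor-cancelʳ = solve 2 (λ a b → (a :+ b) :+ b := a) refl
  where open xor-∧-Solver

xor-interchange : ∀ a b c d → (a xor b) xor (c xor d) ≡ (a xor c) xor (b xor d)
xor-interchange = solve 4 (λ a b c d → (a :+ b) :+ (c :+ d) := (a :+ c) :+ (b :+ d)) refl
  where open xor-∧-Solver

-- The vector space 𝔽₂ᵐ

infixl 6 _⊕_

_⊕_ : Vec Bool m → Vec Bool m → Vec Bool m
_⊕_ = zipWith _xor_

0ᵛ : Vec Bool m
0ᵛ = replicate _ false

⊕-assoc : (x y z : Vec Bool m) → x ⊕ y ⊕ z ≡ x ⊕ (y ⊕ z)
⊕-assoc = zipWith-assoc xor-assoc

⊕-comm : (x y : Vec Bool m) → x ⊕ y ≡ y ⊕ x
⊕-comm = zipWith-comm xor-comm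

⊕-identityˡ : (x : Vec Bool m) → 0ᵛ ⊕ x ≡ x
⊕-identityˡ = zipWith-identityˡ xor-identityˡ

⊕-identityʳ : (x : Vec Bool m) → x ⊕ 0ᵛ ≡ x
⊕-identityʳ = zipWith-identityʳ xor-identityʳ

⊕-self : (x : Vec Bool m) → x ⊕ x ≡ 0ᵛ
⊕-self []      = refl
⊕-self (a ∷ x) = cong₂ _∷_ (xor-same a) (⊕-self x)

⊕-cancelʳ : (x y : Vec Bool m) → x ⊕ y ⊕ y ≡ x
⊕-cancelʳ x y = trans (⊕-assoc x y y) (trans (cong (x ⊕_) (⊕-self y)) (⊕-identityʳ x))

⊕-interchange : (w x y z : Vec Bool m) → (w ⊕ x) ⊕ (y ⊕ z) ≡ (w ⊕ y) ⊕ (x ⊕ z)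
⊕-interchange []      []      []      []      = refl
⊕-interchange (a ∷ w) (b ∷ x) (c ∷ y) (d ∷ z) = cong₂ _∷_ (xor-interchange a b c d) (⊕-interchange w x y z)

scale : Bool → Vec Bool m → Vec Bool m
scale b v = if b then v else 0ᵛ

scale-xor : ∀ b c (v : Vec Bool m) → scale (b xor c) v ≡ scale b v ⊕ scale c v
scale-xor false c     v = sym (⊕-identityˡ _)
scale-xor true  false v = sym (⊕-identityʳ v)
scale-xor true  true  v = sym (⊕-self v)

allVecs-complete : (x : Vec Bool m) → x ∈ allVecs m
allVecs-complete []          = here refl
allVecs-complete (false ∷ x) = ∈-++⁺ˡ (∈-map⁺ (false ∷_) (allVecs-complete x))
allVecs-complete (true ∷ x)  = ∈-++⁺ʳ (map (false ∷_) (allVecs _)) (∈-map⁺ (true ∷_) (allVecs-complete x))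

-- Linear maps and coordinates

IsLinear : (Vec Bool m → Vec Bool m) → Set
IsLinear f = ∀ x y → f (x ⊕ y) ≡ f x ⊕ f y

linear-0ᵛ : {f : Vec Bool m → Vec Bool m} → IsLinear f → f 0ᵛ ≡ 0ᵛ
linear-0ᵛ {f = f} lin = begin
  f 0ᵛ           ≡⟨ cong f (sym (⊕-self 0ᵛ)) ⟩
  f (0ᵛ ⊕ 0ᵛ)    ≡⟨ lin 0ᵛ 0ᵛ ⟩
  f 0ᵛ ⊕ f 0ᵛ    ≡⟨ ⊕-self (f 0ᵛ) ⟩
  0ᵛ             ∎
  where open ≡-Reasoning

record LinearAut (m : ℕ) : Set where
  field
    to from   : Vec Bool m → Vec Bool m
    to-linear : IsLinear to
    to-from   : ∀ y → to (from y) ≡ y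
    from-to   : ∀ x → from (to x) ≡ x

  from-linear : IsLinear from
  from-linear x y = begin
    from (x ⊕ y)                       ≡⟨ cong from (sym (cong₂ _⊕_ (to-from x) (to-from y))) ⟩
    from (to (from x) ⊕ to (from y))   ≡⟨ cong from (sym (to-linear (from x) (from y))) ⟩
    from (to (from x ⊕ from y))        ≡⟨ from-to (from x ⊕ from y) ⟩
    from x ⊕ from y                    ∎
    where open ≡-Reasoning

open LinearAut

idₗ : LinearAut m
idₗ = record { to = id ; from = id ; to-linear = λ _ _ → refl ; to-from = λ _ → refl ; from-to = λ _ → refl }

infixr 9 _∘ₗ_

_∘ₗ_ : LinearAut m → LinearAut m → LinearAut m
A ∘ₗ B = record
  { to        = to A ∘ to B
  ; from      = from B ∘ from A
  ; to-linear = λ x y → trans (cong (to A) (to-linear B x y)) (to-linear A (to B x) (to B y))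
  ; to-from   = λ y → trans (cong (to A) (to-from B (from A y))) (to-from A y)
  ; from-to   = λ x → trans (cong (from B) (from-to A (to B x))) (from-to B x)
  }

involution : (f : Vec Bool m → Vec Bool m) → IsLinear f → (∀ x → f (f x) ≡ x) → LinearAut m
involution f lin inv = record { to = f ; from = f ; to-linear = lin ; to-from = inv ; from-to = inv }

lift₂ : LinearAut m → LinearAut (suc (suc m))
lift₂ A = record
  { to        = λ { (a ∷ b ∷ xs) → a ∷ b ∷ to A xs }
  ; from      = λ { (a ∷ b ∷ xs) → a ∷ b ∷ from A xs }
  ; to-linear = λ { (a ∷ b ∷ xs) (a′ ∷ b′ ∷ ys) → cong (λ v → (a xor a′) ∷ (b xor b′) ∷ v) (to-linear A xs ys) }
  ; to-from   = λ { (a ∷ b ∷ xs) → cong (λ v → a ∷ b ∷ v) (to-from A xs) }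
  ; from-to   = λ { (a ∷ b ∷ xs) → cong (λ v → a ∷ b ∷ v) (from-to A xs) }
  }

unit : Fin m → Vec Bool m
unit zero    = true ∷ 0ᵛ
unit (suc j) = false ∷ unit j

-- In the last clause, abstracting over i ≟ j lets idM (suc i) (suc j) compute to idM i j.
lookup-unit : (i j : Fin m) → lookup (unit j) i ≡ idM i j
lookup-unit zero    zero    = refl
lookup-unit zero    (suc j) = refl
lookup-unit (suc i) zero    = lookup-replicate i false
lookup-unit (suc i) (suc j) with i Fin.≟ j | lookup-unit i j
... | yes _ | eq = eq
... | no _  | eq = eq

xorSum-cong : {f g : Fin m → Bool} → (∀ i → f i ≡ g i) → xorSum f ≡ xorSum g
xorSum-cong {zero}  f≗g = refl
xorSum-cong {suc m} f≗g = cong₂ _xor_ (f≗g zero) (xorSum-cong (f≗g ∘ suc))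

IsAdditive : BoolFun m → Set
IsAdditive φ = ∀ x y → φ (x ⊕ y) ≡ φ x xor φ y

additive-0ᵛ : (φ : BoolFun m) → IsAdditive φ → φ 0ᵛ ≡ false
additive-0ᵛ φ add = trans (cong φ (sym (⊕-self 0ᵛ))) (trans (add 0ᵛ 0ᵛ) (xor-same (φ 0ᵛ)))

additive-expand : (φ : BoolFun m) → IsAdditive φ → ∀ x → φ x ≡ xorSum (λ j → φ (unit j) ∧ lookup x j)
additive-expand {zero}  φ add []      = additive-0ᵛ φ add
additive-expand {suc m} φ add (a ∷ x) = begin
  φ (a ∷ x)
    ≡⟨ cong φ (sym (cong₂ _∷_ (xor-identityʳ a) (⊕-identityˡ x))) ⟩
  φ ((a ∷ 0ᵛ) ⊕ (false ∷ x))
    ≡⟨ add (a ∷ 0ᵛ) (false ∷ x) ⟩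
  φ (a ∷ 0ᵛ) xor φ (false ∷ x)
    ≡⟨ cong₂ _xor_ (first a) (additive-expand (φ ∘ (false ∷_)) (λ x y → add (false ∷ x) (false ∷ y)) x) ⟩
  (φ (unit zero) ∧ a) xor xorSum (λ j → φ (unit (suc j)) ∧ lookup x j) ∎
  where
  open ≡-Reasoning
  first : ∀ a → φ (a ∷ 0ᵛ) ≡ φ (unit zero) ∧ a
  first true  = sym (∧-identityʳ _)
  first false = trans (additive-0ᵛ φ add) (sym (∧-zeroʳ _))

dot-linearʳ : (u x y : Vec Bool m) → dot u (x ⊕ y) ≡ dot u x xor dot u y
dot-linearʳ []      []       []       = refl
dot-linearʳ (a ∷ u) (x₀ ∷ x) (y₀ ∷ y) =
  trans (cong ((a ∧ (x₀ xor y₀)) xor_) (dot-linearʳ u x y)) (distrib a x₀ y₀ (dot u x) (dot u y))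
  where
  distrib : ∀ a x y p q → (a ∧ (x xor y)) xor (p xor q) ≡ ((a ∧ x) xor p) xor ((a ∧ y) xor q)
  distrib = solve 5 (λ a x y p q → (a :* (x :+ y)) :+ (p :+ q) := ((a :* x) :+ p) :+ ((a :* y) :+ q)) refl
    where open xor-∧-Solver

dot-linearˡ : (u v x : Vec Bool m) → dot (u ⊕ v) x ≡ dot u x xor dot v x
dot-linearˡ []      []      []       = refl
dot-linearˡ (a ∷ u) (b ∷ v) (x₀ ∷ x) =
  trans (cong (((a xor b) ∧ x₀) xor_) (dot-linearˡ u v x)) (distrib a b x₀ (dot u x) (dot v x))
  where
  distrib : ∀ a b x p q → ((a xor b) ∧ x) xor (p xor q) ≡ ((a ∧ x) xor p) xor ((b ∧ x) xor q)
  distrib = solve 5 (λ a b x p q → ((a :+ b) :* x) :+ (p :+ q) := ((a :* x) :+ p) :+ ((b :* x) :+ q)) refl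
    where open xor-∧-Solver

transpose : LinearAut m → Vec Bool m → Vec Bool m
transpose A v = tabulate (λ j → dot v (to A (unit j)))

dot-transpose : (A : LinearAut m) (v x : Vec Bool m) → dot v (to A x) ≡ dot (transpose A v) x
dot-transpose A v x = begin
  dot v (to A x)
    ≡⟨ additive-expand (dot v ∘ to A) additive x ⟩
  xorSum (λ j → dot v (to A (unit j)) ∧ lookup x j)
    ≡⟨ xorSum-cong (λ j → cong (_∧ lookup x j) (sym (lookup∘tabulate _ j))) ⟩
  dot (transpose A v) x ∎
  where
  open ≡-Reasoning
  additive : IsAdditive (dot v ∘ to A)
  additive x y = trans (cong (dot v) (to-linear A x y)) (dot-linearʳ v (to A x) (to A y))

matrix : (Vec Bool m → Vec Bool m) → Mat m
matrix f i j = lookup (f (unit j)) i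

module _ {f : Vec Bool m → Vec Bool m} (lin : IsLinear f) where

  coordinate-expand : ∀ i x → lookup (f x) i ≡ xorSum (λ j → matrix f i j ∧ lookup x j)
  coordinate-expand i = additive-expand (λ v → lookup (f v) i) additive
    where
    additive : IsAdditive (λ v → lookup (f v) i)
    additive x y = trans (cong (λ v → lookup v i) (lin x y)) (lookup-zipWith _xor_ i (f x) (f y))

  applyM-matrix : ∀ x → applyM (matrix f) x ≡ f x
  applyM-matrix x = trans (tabulate-cong (λ i → sym (coordinate-expand i x))) (tabulate∘lookup (f x))

  matrix-∘ : ∀ (g : Vec Bool m → Vec Bool m) i j → (matrix f ·M matrix g) i j ≡ matrix (f ∘ g) i j
  matrix-∘ g i j = sym (coordinate-expand i (g (unit j)))

matrix-invertible : (A : LinearAut m) → Invertible (matrix (to A))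
matrix-invertible A = matrix (from A) , inverse (to-linear A) (to-from A) , inverse (from-linear A) (from-to A)
  where
  inverse : ∀ {f g} → IsLinear f → (∀ x → f (g x) ≡ x) → ∀ i j → (matrix f ·M matrix g) i j ≡ idM i j
  inverse {f} {g} lin fg i j = trans (matrix-∘ lin g i j) (trans (cong (λ v → lookup v i) (fg (unit j))) (lookup-unit i j))

-- Quadratic functions on 𝔽₂ᵐ

polar : BoolFun m → Vec Bool m → Vec Bool m → Bool
polar Q x y = Q (x ⊕ y) xor Q x xor Q y xor Q 0ᵛ

Quadratic : BoolFun m → Set
Quadratic Q = ∀ x y z → polar Q (x ⊕ y) z ≡ polar Q x z xor polar Q y z

Nondegenerate : BoolFun m → Set
Nondegenerate Q = ∀ x → (∀ y → polar Q x y ≡ false) → x ≡ 0ᵛ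

module _ (Q : BoolFun m) where

  polar-comm : ∀ x y → polar Q x y ≡ polar Q y x
  polar-comm x y = trans (cong (λ v → Q v xor Q x xor Q y xor Q 0ᵛ) (⊕-comm x y)) (swap (Q (y ⊕ x)) (Q x) (Q y) (Q 0ᵛ))
    where
    swap : ∀ a b c d → a xor (b xor (c xor d)) ≡ a xor (c xor (b xor d))
    swap = solve 4 (λ a b c d → a :+ (b :+ (c :+ d)) := a :+ (c :+ (b :+ d))) refl
      where open xor-∧-Solver

  polar-self : ∀ x → polar Q x x ≡ false
  polar-self x = trans (cong (λ v → Q v xor Q x xor Q x xor Q 0ᵛ) (⊕-self x)) (cancel (Q 0ᵛ) (Q x))
    where
    cancel : ∀ a b → a xor (b xor (b xor a)) ≡ false
    cancel = solve 2 (λ a b → a :+ (b :+ (b :+ a)) := con false) refl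
      where open xor-∧-Solver

  polar-zeroʳ : ∀ x → polar Q x 0ᵛ ≡ false
  polar-zeroʳ x = trans (cong (λ v → Q v xor Q x xor Q 0ᵛ xor Q 0ᵛ) (⊕-identityʳ x)) (cancel (Q x) (Q 0ᵛ))
    where
    cancel : ∀ a b → a xor (a xor (b xor b)) ≡ false
    cancel = solve 2 (λ a b → a :+ (a :+ (b :+ b)) := con false) refl
      where open xor-∧-Solver

  polar-linearʳ : Quadratic Q → ∀ z x y → polar Q z (x ⊕ y) ≡ polar Q z x xor polar Q z y
  polar-linearʳ quad z x y =
    trans (polar-comm z (x ⊕ y)) (trans (quad x y z) (cong₂ _xor_ (polar-comm x z) (polar-comm y z)))

  Q-⊕ : ∀ x y → Q (x ⊕ y) ≡ Q x xor Q y xor Q 0ᵛ xor polar Q x y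
  Q-⊕ x y = unfold (Q (x ⊕ y)) (Q x) (Q y) (Q 0ᵛ)
    where
    unfold : ∀ a b c d → a ≡ b xor (c xor (d xor (a xor (b xor (c xor d)))))
    unfold = solve 4 (λ a b c d → a := b :+ (c :+ (d :+ (a :+ (b :+ (c :+ d)))))) refl
      where open xor-∧-Solver

  nondegenerate-witness : Nondegenerate Q → ∀ {x} → x ≢ 0ᵛ → ∃ λ y → polar Q x y ≡ true
  nondegenerate-witness nd {x} x≢0 with any? (λ y → polar Q x y Bool.≟ true) (allVecs m)
  ... | yes found = satisfied found
  ... | no none   = ⊥-elim (x≢0 (nd x (λ y → ≢true (λ eq → none (Any.map (λ { refl → eq }) (allVecs-complete y))))))
    where
    ≢true : ∀ {b} → ¬ b ≡ true → b ≡ false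
    ≢true {false} _ = refl
    ≢true {true}  h = ⊥-elim (h refl)

module _ (Q : BoolFun m) (A : LinearAut m) where

  polar-∘ : ∀ x y → polar (Q ∘ to A) x y ≡ polar Q (to A x) (to A y)
  polar-∘ x y = cong₂ (λ u v → Q u xor Q (to A x) xor Q (to A y) xor Q v) (to-linear A x y) (linear-0ᵛ (to-linear A))

  quadratic-∘ : Quadratic Q → Quadratic (Q ∘ to A)
  quadratic-∘ quad x y z = begin
    polar (Q ∘ to A) (x ⊕ y) z                                ≡⟨ polar-∘ (x ⊕ y) z ⟩
    polar Q (to A (x ⊕ y)) (to A z)                           ≡⟨ cong (λ v → polar Q v (to A z)) (to-linear A x y) ⟩
    polar Q (to A x ⊕ to A y) (to A z)                        ≡⟨ quad (to A x) (to A y) (to A z) ⟩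
    polar Q (to A x) (to A z) xor polar Q (to A y) (to A z)   ≡⟨ sym (cong₂ _xor_ (polar-∘ x z) (polar-∘ y z)) ⟩
    polar (Q ∘ to A) x z xor polar (Q ∘ to A) y z             ∎
    where open ≡-Reasoning

  nondegenerate-∘ : Nondegenerate Q → Nondegenerate (Q ∘ to A)
  nondegenerate-∘ nd x h = begin
    x                ≡⟨ sym (from-to A x) ⟩
    from A (to A x)  ≡⟨ cong (from A) (nd (to A x) orthogonal) ⟩
    from A 0ᵛ        ≡⟨ linear-0ᵛ (from-linear A) ⟩
    0ᵛ               ∎
    where
    open ≡-Reasoning
    orthogonal : ∀ y → polar Q (to A x) y ≡ false
    orthogonal y = trans (cong (polar Q (to A x)) (sym (to-from A y))) (trans (sym (polar-∘ x (from A y))) (h (from A y)))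

-- Dickson's normal form

data Even : ℕ → Set where
  even-zero : Even zero
  even-2+   : Even m → Even (suc (suc m))

record DicksonForm (Q : BoolFun m) : Set where
  field
    even        : Even m
    basisChange : LinearAut m
    linearPart  : Vec Bool m
    constant    : Bool
    normal      : ∀ x → Q (to basisChange x) ≡ pairsQF x xor affineFun linearPart constant x

dicksonForm-∘ : {Q : BoolFun m} (A : LinearAut m) → DicksonForm (Q ∘ to A) → DicksonForm Q
dicksonForm-∘ A form = record
  { even = even ; basisChange = A ∘ₗ basisChange ; linearPart = linearPart ; constant = constant ; normal = normal }
  where open DicksonForm form

e₀ e₁ : Vec Bool (suc (suc m))
e₀ = true ∷ false ∷ 0ᵛ
e₁ = false ∷ true ∷ 0ᵛ

pad : Vec Bool m → Vec Bool (suc (suc m))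
pad xs = false ∷ false ∷ xs

split₂ : ∀ a b (xs : Vec Bool m) → a ∷ b ∷ xs ≡ (a ∷ b ∷ 0ᵛ) ⊕ pad xs
split₂ a b xs = sym (cong₂ _∷_ (xor-identityʳ a) (cong₂ _∷_ (xor-identityʳ b) (⊕-identityˡ xs)))

polar-cons₂ : (Q : BoolFun (suc (suc m))) → Quadratic Q → ∀ v a b xs →
  polar Q v (a ∷ b ∷ xs) ≡ ((a ∧ polar Q v e₀) xor (b ∧ polar Q v e₁)) xor polar Q v (pad xs)
polar-cons₂ Q quad v a b xs =
  trans (cong (polar Q v) (split₂ a b xs)) (trans (polar-linearʳ Q quad v _ (pad xs)) (cong (_xor _) (plane a b)))
  where
  plane : ∀ a b → polar Q v (a ∷ b ∷ 0ᵛ) ≡ (a ∧ polar Q v e₀) xor (b ∧ polar Q v e₁)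
  plane false false = polar-zeroʳ Q v
  plane true  false = sym (xor-identityʳ _)
  plane false true  = refl
  plane true  true  = trans (cong (λ w → polar Q v (true ∷ true ∷ w)) (sym (⊕-identityˡ 0ᵛ))) (polar-linearʳ Q quad v e₀ e₁)

record SplitsOffPlane (Q : BoolFun (suc (suc m))) : Set where
  field
    quadratic : Quadratic Q
    e₀·e₁     : polar Q e₀ e₁ ≡ true
    e₀⊥       : ∀ xs → polar Q e₀ (pad xs) ≡ false
    e₁⊥       : ∀ xs → polar Q e₁ (pad xs) ≡ false

module SplitOff {Q : BoolFun (suc (suc m))} (splits : SplitsOffPlane Q) where
  open SplitsOffPlane splits

  q₀ q₁ : Bool
  q₀ = Q e₀ xor Q 0ᵛ
  q₁ = Q e₁ xor Q 0ᵛ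

  plane : Bool → Bool → Bool
  plane a b = (a ∧ b) xor ((a ∧ q₀) xor (b ∧ q₁))

  plane-value : ∀ a b → Q (a ∷ b ∷ 0ᵛ) ≡ plane a b xor Q 0ᵛ
  plane-value false false = refl
  plane-value true  false = sym (trans (cong (_xor Q 0ᵛ) (xor-identityʳ q₀)) (xor-cancelʳ (Q e₀) (Q 0ᵛ)))
  plane-value false true  = sym (xor-cancelʳ (Q e₁) (Q 0ᵛ))
  plane-value true  true  = begin
    Q (true ∷ true ∷ 0ᵛ)                        ≡⟨ cong (λ w → Q (true ∷ true ∷ w)) (sym (⊕-identityˡ 0ᵛ)) ⟩
    Q (e₀ ⊕ e₁)                                 ≡⟨ Q-⊕ Q e₀ e₁ ⟩
    Q e₀ xor Q e₁ xor Q 0ᵛ xor polar Q e₀ e₁    ≡⟨ cong (λ p → Q e₀ xor Q e₁ xor Q 0ᵛ xor p) e₀·e₁ ⟩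
    Q e₀ xor Q e₁ xor Q 0ᵛ xor true             ≡⟨ identity (Q e₀) (Q e₁) (Q 0ᵛ) ⟩
    plane true true xor Q 0ᵛ                    ∎
    where
    open ≡-Reasoning
    identity : ∀ e e′ z → e xor (e′ xor (z xor true)) ≡ (true xor ((e xor z) xor (e′ xor z))) xor z
    identity = solve 3 (λ e e′ z → e :+ (e′ :+ (z :+ con true)) := (con true :+ ((e :+ z) :+ (e′ :+ z))) :+ z) refl
      where open xor-∧-Solver

  plane⊥pad : ∀ a b xs → polar Q (a ∷ b ∷ 0ᵛ) (pad xs) ≡ false
  plane⊥pad a b xs = begin
    polar Q (a ∷ b ∷ 0ᵛ) (pad xs)
      ≡⟨ polar-comm Q _ (pad xs) ⟩
    polar Q (pad xs) (a ∷ b ∷ 0ᵛ)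
      ≡⟨ polar-cons₂ Q quadratic (pad xs) a b 0ᵛ ⟩
    ((a ∧ polar Q (pad xs) e₀) xor (b ∧ polar Q (pad xs) e₁)) xor polar Q (pad xs) 0ᵛ
      ≡⟨ cong₂ (λ p p′ → ((a ∧ p) xor (b ∧ p′)) xor polar Q (pad xs) 0ᵛ)
               (trans (polar-comm Q (pad xs) e₀) (e₀⊥ xs)) (trans (polar-comm Q (pad xs) e₁) (e₁⊥ xs)) ⟩
    ((a ∧ false) xor (b ∧ false)) xor polar Q (pad xs) 0ᵛ
      ≡⟨ cong (((a ∧ false) xor (b ∧ false)) xor_) (polar-zeroʳ Q (pad xs)) ⟩
    ((a ∧ false) xor (b ∧ false)) xor false
      ≡⟨ identity a b ⟩
    false ∎
    where
    open ≡-Reasoning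
    identity : ∀ a b → ((a ∧ false) xor (b ∧ false)) xor false ≡ false
    identity = solve 2 (λ a b → (a :* con false :+ b :* con false) :+ con false := con false) refl
      where open xor-∧-Solver

  split : ∀ a b xs → Q (a ∷ b ∷ xs) ≡ plane a b xor Q (pad xs)
  split a b xs = begin
    Q (a ∷ b ∷ xs)
      ≡⟨ cong Q (split₂ a b xs) ⟩
    Q ((a ∷ b ∷ 0ᵛ) ⊕ pad xs)
      ≡⟨ Q-⊕ Q (a ∷ b ∷ 0ᵛ) (pad xs) ⟩
    Q (a ∷ b ∷ 0ᵛ) xor Q (pad xs) xor Q 0ᵛ xor polar Q (a ∷ b ∷ 0ᵛ) (pad xs)
      ≡⟨ cong₂ (λ p r → p xor Q (pad xs) xor Q 0ᵛ xor r) (plane-value a b) (plane⊥pad a b xs) ⟩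
    (plane a b xor Q 0ᵛ) xor Q (pad xs) xor Q 0ᵛ xor false
      ≡⟨ cancel (plane a b) (Q 0ᵛ) (Q (pad xs)) ⟩
    plane a b xor Q (pad xs) ∎
    where
    open ≡-Reasoning
    cancel : ∀ h z r → (h xor z) xor (r xor (z xor false)) ≡ h xor r
    cancel = solve 3 (λ h z r → (h :+ z) :+ (r :+ (z :+ con false)) := h :+ r) refl
      where open xor-∧-Solver

  polar-pad : ∀ xs a b ys → polar Q (pad xs) (a ∷ b ∷ ys) ≡ polar (Q ∘ pad) xs ys
  polar-pad xs a b ys =
    trans (cong₂ (λ u v → u xor Q (pad xs) xor v xor Q 0ᵛ) (split a b (xs ⊕ ys)) (split a b ys))
      (cancel (plane a b) (Q (pad (xs ⊕ ys))) (Q (pad xs)) (Q (pad ys)) (Q 0ᵛ))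
    where
    cancel : ∀ h r r′ r″ z → (h xor r) xor (r′ xor ((h xor r″) xor z)) ≡ r xor (r′ xor (r″ xor z))
    cancel = solve 5 (λ h r r′ r″ z → (h :+ r) :+ (r′ :+ ((h :+ r″) :+ z)) := r :+ (r′ :+ (r″ :+ z))) refl
      where open xor-∧-Solver

  restrict-quadratic : Quadratic (Q ∘ pad)
  restrict-quadratic xs ys zs = quadratic (pad xs) (pad ys) (pad zs)

  restrict-nondegenerate : Nondegenerate Q → Nondegenerate (Q ∘ pad)
  restrict-nondegenerate nd xs h = cong (tail ∘ tail) (nd (pad xs) λ { (a ∷ b ∷ ys) → trans (polar-pad xs a b ys) (h ys) })

  hyperbolic-step : DicksonForm (Q ∘ pad) → DicksonForm Q
  hyperbolic-step form = record
    { even        = even-2+ even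
    ; basisChange = lift₂ basisChange
    ; linearPart  = q₀ ∷ q₁ ∷ linearPart
    ; constant    = constant
    ; normal      = λ { (a ∷ b ∷ xs) → normal₂ a b xs }
    }
    where
    open DicksonForm form
    regroup : ∀ a b q q′ p d c → ((a ∧ b) xor ((a ∧ q) xor (b ∧ q′))) xor (p xor (d xor c))
                               ≡ ((a ∧ b) xor p) xor (((q ∧ a) xor ((q′ ∧ b) xor d)) xor c)
    regroup = solve 7 (λ a b q q′ p d c → ((a :* b) :+ ((a :* q) :+ (b :* q′))) :+ (p :+ (d :+ c))
                                        := ((a :* b) :+ p) :+ (((q :* a) :+ ((q′ :* b) :+ d)) :+ c)) refl
      where open xor-∧-Solver
    normal₂ : ∀ a b xs → Q (a ∷ b ∷ to basisChange xs)
                       ≡ pairsQF (a ∷ b ∷ xs) xor affineFun (q₀ ∷ q₁ ∷ linearPart) constant (a ∷ b ∷ xs)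
    normal₂ a b xs = trans (split a b (to basisChange xs))
      (trans (cong (plane a b xor_) (normal xs)) (regroup a b q₀ q₁ (pairsQF xs) (dot linearPart xs) constant))

module Orthogonalise (Q : BoolFun (suc (suc m))) (quad : Quadratic Q) (e₀·e₁ : polar Q e₀ e₁ ≡ true) where

  c₀ c₁ : Vec Bool m → Bool
  c₀ xs = polar Q e₀ (pad xs)
  c₁ xs = polar Q e₁ (pad xs)

  -- τ (pad xs) = pad xs ⊕ c₁ xs · e₀ ⊕ c₀ xs · e₁ is orthogonal to e₀ and e₁ because B(e₀, e₁) = 1.
  τ : Vec Bool (suc (suc m)) → Vec Bool (suc (suc m))
  τ (a ∷ b ∷ xs) = (a xor c₁ xs) ∷ (b xor c₀ xs) ∷ xs

  τ-linear : IsLinear τ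
  τ-linear (a ∷ b ∷ xs) (a′ ∷ b′ ∷ ys) = cong₂ _∷_
    (trans (cong ((a xor a′) xor_) (polar-linearʳ Q quad e₁ (pad xs) (pad ys))) (xor-interchange a a′ (c₁ xs) (c₁ ys)))
    (cong (_∷ (xs ⊕ ys))
      (trans (cong ((b xor b′) xor_) (polar-linearʳ Q quad e₀ (pad xs) (pad ys))) (xor-interchange b b′ (c₀ xs) (c₀ ys))))

  τ-involutive : ∀ x → τ (τ x) ≡ x
  τ-involutive (a ∷ b ∷ xs) = cong₂ _∷_ (xor-cancelʳ a (c₁ xs)) (cong (_∷ xs) (xor-cancelʳ b (c₀ xs)))

  orthogonalise : LinearAut (suc (suc m))
  orthogonalise = involution τ τ-linear τ-involutive

  τ-plane : ∀ a b → τ (a ∷ b ∷ 0ᵛ) ≡ a ∷ b ∷ 0ᵛ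
  τ-plane a b = trans (cong₂ (λ u v → (a xor u) ∷ (b xor v) ∷ 0ᵛ) (polar-zeroʳ Q e₁) (polar-zeroʳ Q e₀))
                      (cong₂ (λ u v → u ∷ v ∷ 0ᵛ) (xor-identityʳ a) (xor-identityʳ b))

  splitsOffPlane : SplitsOffPlane (Q ∘ τ)
  splitsOffPlane = record
    { quadratic = quadratic-∘ Q orthogonalise quad
    ; e₀·e₁     = trans (polar-∘ Q orthogonalise e₀ e₁) (trans (cong₂ (polar Q) (τ-plane true false) (τ-plane false true)) e₀·e₁)
    ; e₀⊥       = e₀⊥
    ; e₁⊥       = e₁⊥
    }
    where
    open ≡-Reasoning
    e₀⊥ : ∀ xs → polar (Q ∘ τ) e₀ (pad xs) ≡ false
    e₀⊥ xs = begin
      polar (Q ∘ τ) e₀ (pad xs)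
        ≡⟨ polar-∘ Q orthogonalise e₀ (pad xs) ⟩
      polar Q (τ e₀) (c₁ xs ∷ c₀ xs ∷ xs)
        ≡⟨ cong (λ v → polar Q v (c₁ xs ∷ c₀ xs ∷ xs)) (τ-plane true false) ⟩
      polar Q e₀ (c₁ xs ∷ c₀ xs ∷ xs)
        ≡⟨ polar-cons₂ Q quad e₀ (c₁ xs) (c₀ xs) xs ⟩
      ((c₁ xs ∧ polar Q e₀ e₀) xor (c₀ xs ∧ polar Q e₀ e₁)) xor c₀ xs
        ≡⟨ cong₂ (λ u v → ((c₁ xs ∧ u) xor (c₀ xs ∧ v)) xor c₀ xs) (polar-self Q e₀) e₀·e₁ ⟩
      ((c₁ xs ∧ false) xor (c₀ xs ∧ true)) xor c₀ xs
        ≡⟨ cancel (c₁ xs) (c₀ xs) ⟩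
      false ∎
      where
      cancel : ∀ u v → ((u ∧ false) xor (v ∧ true)) xor v ≡ false
      cancel = solve 2 (λ u v → ((u :* con false) :+ (v :* con true)) :+ v := con false) refl
        where open xor-∧-Solver
    e₁⊥ : ∀ xs → polar (Q ∘ τ) e₁ (pad xs) ≡ false
    e₁⊥ xs = begin
      polar (Q ∘ τ) e₁ (pad xs)
        ≡⟨ polar-∘ Q orthogonalise e₁ (pad xs) ⟩
      polar Q (τ e₁) (c₁ xs ∷ c₀ xs ∷ xs)
        ≡⟨ cong (λ v → polar Q v (c₁ xs ∷ c₀ xs ∷ xs)) (τ-plane false true) ⟩
      polar Q e₁ (c₁ xs ∷ c₀ xs ∷ xs)
        ≡⟨ polar-cons₂ Q quad e₁ (c₁ xs) (c₀ xs) xs ⟩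
      ((c₁ xs ∧ polar Q e₁ e₀) xor (c₀ xs ∧ polar Q e₁ e₁)) xor c₁ xs
        ≡⟨ cong₂ (λ u v → ((c₁ xs ∧ u) xor (c₀ xs ∧ v)) xor c₁ xs) (trans (polar-comm Q e₁ e₀) e₀·e₁) (polar-self Q e₁) ⟩
      ((c₁ xs ∧ true) xor (c₀ xs ∧ false)) xor c₁ xs
        ≡⟨ cancel (c₁ xs) (c₀ xs) ⟩
      false ∎
      where
      cancel : ∀ u v → ((u ∧ true) xor (v ∧ false)) xor u ≡ false
      cancel = solve 2 (λ u v → ((u :* con true) :+ (v :* con false)) :+ u := con false) refl
        where open xor-∧-Solver

module Shear (d : Bool) (ds : Vec Bool m) where

  σ : Vec Bool (suc (suc m)) → Vec Bool (suc (suc m))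
  σ (a ∷ b ∷ xs) = (a xor (b ∧ d)) ∷ b ∷ (xs ⊕ scale b ds)

  σ-linear : IsLinear σ
  σ-linear (a ∷ b ∷ xs) (a′ ∷ b′ ∷ ys) = cong₂ _∷_ (head-linear a a′ b b′ d)
    (cong ((b xor b′) ∷_) (trans (cong (xs ⊕ ys ⊕_) (scale-xor b b′ ds)) (⊕-interchange xs ys (scale b ds) (scale b′ ds))))
    where
    head-linear : ∀ a a′ b b′ d → (a xor a′) xor ((b xor b′) ∧ d) ≡ (a xor (b ∧ d)) xor (a′ xor (b′ ∧ d))
    head-linear = solve 5 (λ a a′ b b′ d → (a :+ a′) :+ ((b :+ b′) :* d) := (a :+ (b :* d)) :+ (a′ :+ (b′ :* d))) refl
      where open xor-∧-Solver

  σ-involutive : ∀ x → σ (σ x) ≡ x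
  σ-involutive (a ∷ b ∷ xs) = cong₂ _∷_ (xor-cancelʳ a (b ∧ d)) (cong (b ∷_) (⊕-cancelʳ xs (scale b ds)))

  shear : LinearAut (suc (suc m))
  shear = involution σ σ-linear σ-involutive

  σ-e₀ : σ e₀ ≡ e₀
  σ-e₀ = cong (λ v → true ∷ false ∷ v) (⊕-identityˡ 0ᵛ)

  σ-e₁ : σ e₁ ≡ d ∷ true ∷ ds
  σ-e₁ = cong (λ v → d ∷ true ∷ v) (⊕-identityˡ ds)

-- A partner y of e₀ (B(e₀, y) = 1) may be taken with y₁ = 1: otherwise e₁ or y ⊕ e₁ is one.
partner : (Q : BoolFun (suc (suc m))) → Quadratic Q → Nondegenerate Q → ∃₂ λ d ds → polar Q e₀ (d ∷ true ∷ ds) ≡ true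
partner Q quad nd with nondegenerate-witness Q nd {e₀} (λ ())
... | d ∷ true  ∷ ds , e₀·y = d , ds , e₀·y
... | d ∷ false ∷ ds , e₀·y with polar Q e₀ e₁ in e₀·e₁
...   | true  = false , 0ᵛ , e₀·e₁
...   | false = d , ds , (begin
  polar Q e₀ (d ∷ true ∷ ds)
    ≡⟨ cong (polar Q e₀) (sym (cong₂ _∷_ (xor-identityʳ d) (cong (true ∷_) (⊕-identityʳ ds)))) ⟩
  polar Q e₀ ((d ∷ false ∷ ds) ⊕ e₁)
    ≡⟨ polar-linearʳ Q quad e₀ (d ∷ false ∷ ds) e₁ ⟩
  polar Q e₀ (d ∷ false ∷ ds) xor polar Q e₀ e₁
    ≡⟨ cong₂ _xor_ e₀·y e₀·e₁ ⟩
  true ∎)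
  where open ≡-Reasoning

splitOffPlane : (Q : BoolFun (suc (suc m))) → Quadratic Q → Nondegenerate Q → ∃ λ A → SplitsOffPlane (Q ∘ to A)
splitOffPlane Q quad nd = shear ∘ₗ orthogonalise , splitsOffPlane
  where
  d = proj₁ (partner Q quad nd)
  ds = proj₁ (proj₂ (partner Q quad nd))
  open Shear d ds
  quad₁ : Quadratic (Q ∘ σ)
  quad₁ = quadratic-∘ Q shear quad
  e₀·e₁ : polar (Q ∘ σ) e₀ e₁ ≡ true
  e₀·e₁ = trans (polar-∘ Q shear e₀ e₁) (trans (cong₂ (polar Q) σ-e₀ σ-e₁) (proj₂ (proj₂ (partner Q quad nd))))
  open Orthogonalise (Q ∘ σ) quad₁ e₀·e₁ using (orthogonalise; splitsOffPlane)

dickson : (Q : BoolFun m) → Quadratic Q → Nondegenerate Q → DicksonForm Q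
dickson {zero} Q _ _ = record
  { even = even-zero ; basisChange = idₗ ; linearPart = [] ; constant = Q [] ; normal = λ { [] → refl } }
dickson {suc zero} Q _ nd with nd (true ∷ []) (λ { (false ∷ []) → polar-zeroʳ Q _ ; (true ∷ []) → polar-self Q _ })
... | ()
dickson {suc (suc m)} Q quad nd =
  dicksonForm-∘ A (hyperbolic-step (dickson (Q ∘ to A ∘ pad) restrict-quadratic (restrict-nondegenerate (nondegenerate-∘ Q A nd))))
  where
  A = proj₁ (splitOffPlane Q quad nd)
  open SplitOff (proj₂ (splitOffPlane Q quad nd))

-- (a ⊕ u₁)(b ⊕ u₀) absorbs the linear terms u₀a ⊕ u₁b, at the cost of the constant u₀u₁.
completeSquare : Even m → (u : Vec Bool m) (ε : Bool) →
  ∃₂ λ t ε′ → ∀ x → pairsQF (x ⊕ t) xor affineFun u ε (x ⊕ t) ≡ pairsQF x xor ε′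
completeSquare even-zero [] ε = [] , ε , λ { [] → refl }
completeSquare (even-2+ ev) (u₀ ∷ u₁ ∷ us) ε = u₁ ∷ u₀ ∷ t , (u₀ ∧ u₁) xor ε′ , λ { (a ∷ b ∷ xs) → square a b xs }
  where
  t = proj₁ (completeSquare ev us ε)
  ε′ = proj₁ (proj₂ (completeSquare ev us ε))
  expand : ∀ a b u₀ u₁ p d ε → (((a xor u₁) ∧ (b xor u₀)) xor p) xor (((u₀ ∧ (a xor u₁)) xor ((u₁ ∧ (b xor u₀)) xor d)) xor ε)
                             ≡ ((a ∧ b) xor (u₀ ∧ u₁)) xor (p xor (d xor ε))
  expand = solve 7 (λ a b u₀ u₁ p d ε → (((a :+ u₁) :* (b :+ u₀)) :+ p) :+ (((u₀ :* (a :+ u₁)) :+ ((u₁ :* (b :+ u₀)) :+ d)) :+ ε)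
                                      := ((a :* b) :+ (u₀ :* u₁)) :+ (p :+ (d :+ ε))) refl
    where open xor-∧-Solver
  square : ∀ a b xs → pairsQF ((a ∷ b ∷ xs) ⊕ (u₁ ∷ u₀ ∷ t)) xor affineFun (u₀ ∷ u₁ ∷ us) ε ((a ∷ b ∷ xs) ⊕ (u₁ ∷ u₀ ∷ t))
                    ≡ pairsQF (a ∷ b ∷ xs) xor ((u₀ ∧ u₁) xor ε′)
  square a b xs = begin
    (((a xor u₁) ∧ (b xor u₀)) xor pairsQF (xs ⊕ t)) xor (((u₀ ∧ (a xor u₁)) xor ((u₁ ∧ (b xor u₀)) xor dot us (xs ⊕ t))) xor ε)
      ≡⟨ expand a b u₀ u₁ (pairsQF (xs ⊕ t)) (dot us (xs ⊕ t)) ε ⟩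
    ((a ∧ b) xor (u₀ ∧ u₁)) xor (pairsQF (xs ⊕ t) xor (dot us (xs ⊕ t) xor ε))
      ≡⟨ cong (((a ∧ b) xor (u₀ ∧ u₁)) xor_) (proj₂ (proj₂ (completeSquare ev us ε)) xs) ⟩
    ((a ∧ b) xor (u₀ ∧ u₁)) xor (pairsQF xs xor ε′)
      ≡⟨ xor-interchange (a ∧ b) (u₀ ∧ u₁) (pairsQF xs) ε′ ⟩
    ((a ∧ b) xor pairsQF xs) xor ((u₀ ∧ u₁) xor ε′) ∎
    where open ≡-Reasoning

dicksonForm-affineEquivalent : {Q : BoolFun m} → DicksonForm Q → Σ Bool λ ε → AffineEquivalent Q (λ x → pairsQF x xor ε)
dicksonForm-affineEquivalent {Q = Q} form = ε′ , matrix (to A) , to A t , matrix-invertible A , translate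
  where
  open DicksonForm form renaming (basisChange to A)
  t = proj₁ (completeSquare even linearPart constant)
  ε′ = proj₁ (proj₂ (completeSquare even linearPart constant))
  translate : ∀ x → pairsQF x xor ε′ ≡ Q (applyM (matrix (to A)) x ⊕ to A t)
  translate x = sym (begin
    Q (applyM (matrix (to A)) x ⊕ to A t)
      ≡⟨ cong (λ v → Q (v ⊕ to A t)) (applyM-matrix (to-linear A) x) ⟩
    Q (to A x ⊕ to A t)
      ≡⟨ cong Q (sym (to-linear A x t)) ⟩
    Q (to A (x ⊕ t))
      ≡⟨ normal (x ⊕ t) ⟩
    pairsQF (x ⊕ t) xor affineFun linearPart constant (x ⊕ t)
      ≡⟨ proj₂ (proj₂ (completeSquare even linearPart constant)) x ⟩
    pairsQF x xor ε′ ∎)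
    where open ≡-Reasoning

module Bentness where
  open import Data.Nat using (_+_; _*_)
  open import Data.Nat.Properties using (+-comm; +-identityʳ; +-cancelˡ-≡)

  indicator : Bool → ℕ
  indicator b = if b then 1 else 0

  count : (X → Bool) → List X → ℕ
  count f xs = sum (map (indicator ∘ f) xs)

  count-filter : ∀ (f : X → Bool) xs → length (filter (λ x → f x Bool.≟ true) xs) ≡ count f xs
  count-filter f []       = refl
  count-filter f (x ∷ xs) with f x
  ... | true  = cong suc (count-filter f xs)
  ... | false = count-filter f xs

  dist≡count : (F G : BoolFun r) → dist F G ≡ count (λ x → F x xor G x) (allVecs r)
  dist≡count F G = count-filter (λ x → F x xor G x) (allVecs _)

  count-cong : {f g : X → Bool} → (∀ x → f x ≡ g x) → ∀ xs → count f xs ≡ count g xs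
  count-cong f≗g xs = cong sum (map-cong (cong indicator ∘ f≗g) xs)

  count-cons : (f : BoolFun (suc r)) →
    count f (allVecs (suc r)) ≡ count (f ∘ (false ∷_)) (allVecs r) + count (f ∘ (true ∷_)) (allVecs r)
  count-cons {r} f = begin
    sum (map g (map (false ∷_) vs ++ map (true ∷_) vs))
      ≡⟨ cong sum (map-++ g (map (false ∷_) vs) _) ⟩
    sum (map g (map (false ∷_) vs) ++ map g (map (true ∷_) vs))
      ≡⟨ sum-++ (map g (map (false ∷_) vs)) _ ⟩
    sum (map g (map (false ∷_) vs)) + sum (map g (map (true ∷_) vs))
      ≡⟨ sym (cong₂ _+_ (cong sum (map-∘ vs)) (cong sum (map-∘ vs))) ⟩
    count (f ∘ (false ∷_)) vs + count (f ∘ (true ∷_)) vs ∎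
    where
    open ≡-Reasoning
    vs = allVecs r
    g = indicator ∘ f

  count-complement : (f : X → Bool) → ∀ xs → count f xs + count (not ∘ f) xs ≡ length xs
  count-complement f []       = refl
  count-complement f (x ∷ xs) with f x
  ... | true  = cong suc (count-complement f xs)
  ... | false = trans (+-comm (count f xs) (suc _)) (cong suc (trans (+-comm _ (count f xs)) (count-complement f xs)))

  length-allVecs : ∀ r → length (allVecs r) ≡ 2 ^ r
  length-allVecs zero    = refl
  length-allVecs (suc r) = begin
    length (map (false ∷_) (allVecs r) ++ map (true ∷_) (allVecs r))
      ≡⟨ length-++ (map (false ∷_) (allVecs r)) ⟩
    length (map (false ∷_) (allVecs r)) + length (map (true ∷_) (allVecs r))
      ≡⟨ cong₂ _+_ (length-map _ (allVecs r)) (length-map _ (allVecs r)) ⟩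
    length (allVecs r) + length (allVecs r)
      ≡⟨ cong₂ _+_ (length-allVecs r) (trans (length-allVecs r) (sym (+-identityʳ (2 ^ r)))) ⟩
    2 ^ suc r ∎
    where open ≡-Reasoning

  allVecs-unique : ∀ r → Unique (allVecs r)
  allVecs-unique zero    = All.[] AllPairs.∷ AllPairs.[]
  allVecs-unique (suc r) = Unique.++⁺ (Unique.map⁺ ∷-injectiveʳ (allVecs-unique r)) (Unique.map⁺ ∷-injectiveʳ (allVecs-unique r)) disjoint
    where
    ∷-injectiveʳ : ∀ {b} {x y : Vec Bool r} → b ∷ x ≡ b ∷ y → x ≡ y
    ∷-injectiveʳ refl = refl
    disjoint : ∀ {v} → ¬ (v ∈ map (false ∷_) (allVecs r) × v ∈ map (true ∷_) (allVecs r))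
    disjoint (p , q) with ∈-map⁻ (false ∷_) p | ∈-map⁻ (true ∷_) q
    ... | _ , _ , refl | _ , _ , ()

  count-∘-aut : (A : LinearAut r) (f : BoolFun r) → count f (allVecs r) ≡ count (f ∘ to A) (allVecs r)
  count-∘-aut {r} A f = begin
    count f (allVecs r)                ≡⟨ sum-↭ (↭.map⁺ (indicator ∘ f) (↭-sym to-permutes)) ⟩
    count f (map (to A) (allVecs r))   ≡⟨ cong sum (sym (map-∘ (allVecs r))) ⟩
    count (f ∘ to A) (allVecs r)       ∎
    where
    open ≡-Reasoning
    injective : ∀ {x y} → to A x ≡ to A y → x ≡ y
    injective {x} {y} eq = trans (sym (from-to A x)) (trans (cong (from A) eq) (from-to A y))
    to-permutes : map (to A) (allVecs r) ↭ allVecs r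
    to-permutes = ∼bag⇒↭ (unique∧set⇒bag (Unique.map⁺ injective (allVecs-unique r)) (allVecs-unique r)
      (λ {v} → mk⇔ (λ _ → allVecs-complete v)
                   (λ _ → subst (_∈ map (to A) (allVecs r)) (to-from A v) (∈-map⁺ (to A) (allVecs-complete (from A v))))))

  -- IsBent r F unfolds to ∀ u c → dist F (affineFun u c) ≈ 2 ^ (r ∸ 1) ± 2 ^ (⌊ r /2⌋ ∸ 1).
  infix 4 _≈_±_

  _≈_±_ : ℕ → ℕ → ℕ → Set
  d ≈ h ± s = d ≡ h + s ⊎ d + s ≡ h

  ±-complement : ∀ {d e h s} → d + e ≡ 2 * h → d ≈ h ± s → e ≈ h ± s
  ±-complement {e = e} {h} {s} total (inj₁ refl) =
    inj₂ (+-cancelˡ-≡ h _ _ (trans (identity h s e) (trans total (cong (h +_) (+-identityʳ h)))))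
    where
    identity : ∀ h s e → h + (e + s) ≡ h + s + e
    identity = solve-∀
  ±-complement {d} {e} {s = s} total (inj₂ refl) = inj₁ (+-cancelˡ-≡ d _ _ (trans total (identity d s)))
    where
    identity : ∀ d s → d + s + (d + s + 0) ≡ d + (d + s + s)
    identity = solve-∀

  ±-three-one : ∀ {d e h s} → d + e ≡ 2 * h → d ≈ h ± s → (d + d) + (d + e) ≈ 2 * (2 * h) ± 2 * s
  ±-three-one {e = e} {h} {s} total (inj₁ refl) = inj₁ (trans (cong (h + s + (h + s) +_) total) (identity h s))
    where
    identity : ∀ h s → h + s + (h + s) + 2 * h ≡ 2 * (2 * h) + 2 * s
    identity = solve-∀
  ±-three-one {d} {e} {s = s} total (inj₂ refl) = inj₂ (trans (cong (λ t → d + d + t + 2 * s) total) (identity d s))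
    where
    identity : ∀ d s → d + d + 2 * (d + s) + 2 * s ≡ 2 * (2 * (d + s))
    identity = solve-∀

  module _ {m : ℕ} (u₀ u₁ : Bool) (us : Vec Bool m) (c : Bool) where

    private
      g : BoolFun m
      g xs = pairsQF xs xor affineFun us c xs

      plane : Bool → Bool → Bool
      plane a b = (a ∧ b) xor ((u₀ ∧ a) xor (u₁ ∧ b))

      quarter : Bool → Bool → ℕ
      quarter a b = count (λ xs → plane a b xor g xs) (allVecs m)

    dist-quarters : dist pairsQF (affineFun (u₀ ∷ u₁ ∷ us) c) ≡ (quarter false false + quarter false true) + (quarter true false + quarter true true)
    dist-quarters = begin
      dist pairsQF (affineFun (u₀ ∷ u₁ ∷ us) c)
        ≡⟨ dist≡count pairsQF (affineFun (u₀ ∷ u₁ ∷ us) c) ⟩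
      count F (allVecs (suc (suc m)))
        ≡⟨ count-cons F ⟩
      count (F ∘ (false ∷_)) (allVecs (suc m)) + count (F ∘ (true ∷_)) (allVecs (suc m))
        ≡⟨ cong₂ _+_ (count-cons (F ∘ (false ∷_))) (count-cons (F ∘ (true ∷_))) ⟩
      (count (F ∘ (false ∷_) ∘ (false ∷_)) vs + count (F ∘ (false ∷_) ∘ (true ∷_)) vs)
        + (count (F ∘ (true ∷_) ∘ (false ∷_)) vs + count (F ∘ (true ∷_) ∘ (true ∷_)) vs)
        ≡⟨ cong₂ _+_ (cong₂ _+_ (regroup false false) (regroup false true)) (cong₂ _+_ (regroup true false) (regroup true true)) ⟩
      (quarter false false + quarter false true) + (quarter true false + quarter true true) ∎
      where
      open ≡-Reasoning
      vs = allVecs m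
      F : BoolFun (suc (suc m))
      F x = pairsQF x xor affineFun (u₀ ∷ u₁ ∷ us) c x
      identity : ∀ ab p a′ b′ d c → (ab xor p) xor ((a′ xor (b′ xor d)) xor c) ≡ (ab xor (a′ xor b′)) xor (p xor (d xor c))
      identity = solve 6 (λ ab p a′ b′ d c → (ab :+ p) :+ ((a′ :+ (b′ :+ d)) :+ c) := (ab :+ (a′ :+ b′)) :+ (p :+ (d :+ c))) refl
        where open xor-∧-Solver
      regroup : ∀ a b → count (λ xs → F (a ∷ b ∷ xs)) vs ≡ quarter a b
      regroup a b = count-cong (λ xs → identity (a ∧ b) (pairsQF xs) (u₀ ∧ a) (u₁ ∧ b) (dot us xs) c) vs

  -- Let d and e count the points where g = pairsQF ⊕ affineFun us c is 1 and 0.  The quarter at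
  -- (a, b) is e if ab ⊕ u₀a ⊕ u₁b = 1 and d otherwise; that happens at one (a, b), or at three
  -- when u₀ = u₁ = 1.
  pairsQF-bent : Even m → IsBent (suc (suc m)) pairsQF
  pairsQF-bent even-zero (u₀ ∷ u₁ ∷ []) c = base u₀ u₁ c
    where
    base : ∀ u₀ u₁ c → dist pairsQF (affineFun (u₀ ∷ u₁ ∷ []) c) ≈ 2 ± 1
    base false false false = inj₂ refl
    base false false true  = inj₁ refl
    base false true  false = inj₂ refl
    base false true  true  = inj₁ refl
    base true  false false = inj₂ refl
    base true  false true  = inj₁ refl
    base true  true  false = inj₁ refl
    base true  true  true  = inj₂ refl
  pairsQF-bent {m = suc (suc m)} (even-2+ ev) (u₀ ∷ u₁ ∷ us) c = combine u₀ u₁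
    where
    g : BoolFun (suc (suc m))
    g xs = pairsQF xs xor affineFun us c xs
    d e : ℕ
    d = count g (allVecs (suc (suc m)))
    e = count (not ∘ g) (allVecs (suc (suc m)))
    total : d + e ≡ 2 * 2 ^ suc m
    total = trans (count-complement g (allVecs (suc (suc m)))) (length-allVecs (suc (suc m)))
    d≈ : d ≈ 2 ^ suc m ± 2 ^ ⌊ m /2⌋
    d≈ = subst (_≈ _ ± _) (dist≡count pairsQF (affineFun us c)) (pairsQF-bent ev us c)
    d+d+[d+e]≈ : d + d + (d + e) ≈ 2 * (2 * 2 ^ suc m) ± 2 * 2 ^ ⌊ m /2⌋
    d+d+[d+e]≈ = ±-three-one total d≈
    e+e+[e+d]≈ : e + e + (e + d) ≈ 2 * (2 * 2 ^ suc m) ± 2 * 2 ^ ⌊ m /2⌋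
    e+e+[e+d]≈ = ±-three-one (trans (+-comm e d) total) (±-complement total d≈)
    combine : ∀ u₀ u₁ → dist pairsQF (affineFun (u₀ ∷ u₁ ∷ us) c) ≈ 2 * (2 * 2 ^ suc m) ± 2 * 2 ^ ⌊ m /2⌋
    combine false false = subst (_≈ _ ± _) (sym (dist-quarters false false us c)) d+d+[d+e]≈
    combine true  false = subst (_≈ _ ± _) (sym (trans (dist-quarters true false us c) (cong (d + d +_) (+-comm e d)))) d+d+[d+e]≈
    combine false true  = subst (_≈ _ ± _) (sym (trans (dist-quarters false true us c) (+-comm (d + e) (d + d)))) d+d+[d+e]≈
    combine true  true  = subst (_≈ _ ± _) (sym (trans (dist-quarters true true us c)
                            (trans (+-comm (d + e) (e + e)) (cong (e + e +_) (+-comm d e))))) e+e+[e+d]≈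

  bent-transfer : {Q F : BoolFun m} (A : LinearAut m) (u : Vec Bool m) (ε : Bool) →
    (∀ x → Q (to A x) ≡ F x xor affineFun u ε x) → IsBent m F → IsBent m Q
  bent-transfer {m} {Q} {F} A u ε Q∘A bentF v c = subst (_≈ _ ± _) (sym same-distance) (bentF (u ⊕ transpose A v) (ε xor c))
    where
    open ≡-Reasoning
    identity : ∀ f d ε e c → (f xor (d xor ε)) xor (e xor c) ≡ f xor ((d xor e) xor (ε xor c))
    identity = solve 5 (λ f d ε e c → (f :+ (d :+ ε)) :+ (e :+ c) := f :+ ((d :+ e) :+ (ε :+ c))) refl
      where open xor-∧-Solver
    pointwise : ∀ x → Q (to A x) xor affineFun v c (to A x) ≡ F x xor affineFun (u ⊕ transpose A v) (ε xor c) x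
    pointwise x = begin
      Q (to A x) xor (dot v (to A x) xor c)
        ≡⟨ cong₂ (λ p q → p xor (q xor c)) (Q∘A x) (dot-transpose A v x) ⟩
      (F x xor (dot u x xor ε)) xor (dot (transpose A v) x xor c)
        ≡⟨ identity (F x) (dot u x) ε (dot (transpose A v) x) c ⟩
      F x xor ((dot u x xor dot (transpose A v) x) xor (ε xor c))
        ≡⟨ cong (λ p → F x xor (p xor (ε xor c))) (sym (dot-linearˡ u (transpose A v) x)) ⟩
      F x xor affineFun (u ⊕ transpose A v) (ε xor c) x ∎
    same-distance : dist Q (affineFun v c) ≡ dist F (affineFun (u ⊕ transpose A v) (ε xor c))
    same-distance = begin
      dist Q (affineFun v c)                                          ≡⟨ dist≡count Q (affineFun v c) ⟩
      count (λ x → Q x xor affineFun v c x) (allVecs m)               ≡⟨ count-∘-aut A _ ⟩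
      count (λ x → Q (to A x) xor affineFun v c (to A x)) (allVecs m) ≡⟨ count-cong pointwise (allVecs m) ⟩
      count (λ x → F x xor affineFun (u ⊕ transpose A v) (ε xor c) x) (allVecs m)
                                                                      ≡⟨ sym (dist≡count F _) ⟩
      dist F (affineFun (u ⊕ transpose A v) (ε xor c)) ∎

  dicksonForm-bent : {Q : BoolFun m} → DicksonForm Q → 1 ≤ m → IsBent m Q
  dicksonForm-bent {Q = Q} form 1≤m with DicksonForm.even form
  ... | even-2+ ev = bent-transfer {Q = Q} {F = pairsQF} basisChange linearPart constant normal (pairsQF-bent ev)
    where open DicksonForm form

open Bentness using (dicksonForm-bent)

nondegenerate-bent-affineEquivalent : (Q : BoolFun m) → Quadratic Q → Nondegenerate Q → 1 ≤ m →
  IsBent m Q × Σ Bool (λ ε → AffineEquivalent Q (λ x → pairsQF x xor ε))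
nondegenerate-bent-affineEquivalent Q quad nd 1≤m = dicksonForm-bent form 1≤m , dicksonForm-affineEquivalent form
  where form = dickson Q quad nd

module FiniteField {n : ℕ} (F : GF2^ n) where

  open GF2^ F
  open IsCommutativeRing isCommutativeRing public
    using (+-assoc; +-comm; +-identityˡ; +-identityʳ; *-assoc; *-comm; *-identityˡ; *-identityʳ;
           distribˡ; distribʳ; zeroˡ; zeroʳ)
  open IsCommutativeRing isCommutativeRing using (-‿inverseʳ; *-isCommutativeMonoid)

  ring : CommutativeRing _ _
  ring = record { isCommutativeRing = isCommutativeRing }

  x+x≡0 : ∀ x → x + x ≡ 0#
  x+x≡0 = -‿inverseʳ

  fromBool : Bool → K
  fromBool b = scal b 1#

  scal-xor : ∀ b c w → scal (b xor c) w ≡ scal b w + scal c w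
  scal-xor false c     w = sym (+-identityˡ _)
  scal-xor true  false w = sym (+-identityʳ w)
  scal-xor true  true  w = sym (x+x≡0 w)

  scal-fromBool : ∀ b w → scal b w ≡ fromBool b * w
  scal-fromBool false w = sym (zeroˡ w)
  scal-fromBool true  w = sym (*-identityˡ w)

  fromBool-xor : ∀ b c → fromBool (b xor c) ≡ fromBool b + fromBool c
  fromBool-xor b c = scal-xor b c 1#

  fromBool-injective : ∀ {b c} → fromBool b ≡ fromBool c → b ≡ c
  fromBool-injective {false} {false} _  = refl
  fromBool-injective {false} {true}  eq = ⊥-elim (0≢1 eq)
  fromBool-injective {true}  {false} eq = ⊥-elim (0≢1 (sym eq))
  fromBool-injective {true}  {true}  _  = refl

  fromBool-∧ : ∀ b c → fromBool (b ∧ c) ≡ fromBool b * fromBool c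
  fromBool-∧ false c = sym (zeroˡ _)
  fromBool-∧ true  c = sym (*-identityˡ _)

  fromBool-morphism : CommutativeRing.rawRing Bool.xor-∧-commutativeRing -Raw-AlmostCommutative⟶ fromCommutativeRing ring
  fromBool-morphism = record
    { ⟦_⟧    = fromBool
    ; +-homo = fromBool-xor
    ; *-homo = fromBool-∧
    ; -‿homo = λ _ → refl
    ; 0-homo = refl
    ; 1-homo = refl
    }

  coefficient≟ : ∀ b c → Maybe (fromBool b ≡ fromBool c)
  coefficient≟ b c = Maybe.map (cong fromBool) (dec⇒maybe (b Bool.≟ c))

  -- The ring solver for K with coefficients in 𝔽₂: normal forms are computed with 1 + 1 = 0, so
  -- identities of characteristic 2 such as (x + y)² = x² + y² are proved by normalisation.
  module 𝔽₂-Solver = Algebra.Solver.Ring (CommutativeRing.rawRing Bool.xor-∧-commutativeRing) (fromCommutativeRing ring) fromBool-morphism coefficient≟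

  infix 10 _²
  _² : K → K
  x ² = x * x

  ²-+ : ∀ x y → (x + y) ² ≡ x ² + y ²
  ²-+ = solve 2 (λ x y → (x :+ y) :* (x :+ y) := x :* x :+ y :* y) refl
    where open 𝔽₂-Solver

  +-interchange : ∀ a b c d → a + b + (c + d) ≡ a + c + (b + d)
  +-interchange = solve 4 (λ a b c d → a :+ b :+ (c :+ d) := a :+ c :+ (b :+ d)) refl
    where open 𝔽₂-Solver

  module Card = Inverse card

  infix 4 _≟_
  _≟_ : (x y : K) → Dec (x ≡ y)
  x ≟ y with Card.from x Fin.≟ Card.from y
  ... | yes eq = yes (trans (sym (Card.strictlyInverseˡ x)) (trans (cong Card.to eq) (Card.strictlyInverseˡ y)))
  ... | no neq = no (neq ∘ cong Card.from)

  inverseˡ : ∀ x → x ≢ 0# → x ⁻¹ * x ≡ 1#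
  inverseˡ x x≢0 = trans (*-comm (x ⁻¹) x) (inverse x x≢0)

  *-cancelˡ : ∀ {x} y z → x ≢ 0# → x * y ≡ x * z → y ≡ z
  *-cancelˡ {x} y z x≢0 eq = begin
    y                ≡⟨ sym (trans (cong (_* y) (inverseˡ x x≢0)) (*-identityˡ y)) ⟩
    x ⁻¹ * x * y     ≡⟨ *-assoc (x ⁻¹) x y ⟩
    x ⁻¹ * (x * y)   ≡⟨ cong (x ⁻¹ *_) eq ⟩
    x ⁻¹ * (x * z)   ≡⟨ sym (*-assoc (x ⁻¹) x z) ⟩
    x ⁻¹ * x * z     ≡⟨ trans (cong (_* z) (inverseˡ x x≢0)) (*-identityˡ z) ⟩
    z                ∎
    where open ≡-Reasoning

  *-nonzero : ∀ {x y} → x ≢ 0# → y ≢ 0# → x * y ≢ 0#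
  *-nonzero {x} {y} x≢0 y≢0 xy≡0 = y≢0 (*-cancelˡ y 0# x≢0 (trans xy≡0 (sym (zeroʳ x))))

  +-cancelˡ : ∀ x {y z} → x + y ≡ x + z → y ≡ z
  +-cancelˡ x {y} {z} eq = trans (sym (x+[x+y]≡y x y)) (trans (cong (x +_) eq) (x+[x+y]≡y x z))
    where
    x+[x+y]≡y : ∀ x y → x + (x + y) ≡ y
    x+[x+y]≡y = solve 2 (λ x y → x :+ (x :+ y) := y) refl
      where open 𝔽₂-Solver

  sum≡0⇒≡ : ∀ {x y} → x + y ≡ 0# → x ≡ y
  sum≡0⇒≡ {x} eq = sym (+-cancelˡ x (trans eq (sym (x+x≡0 x))))

  idempotent⇒fromBool : ∀ {x} → x ² ≡ x → ∃ λ b → x ≡ fromBool b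
  idempotent⇒fromBool {x} x²≡x with x ≟ 0#
  ... | yes x≡0 = false , x≡0
  ... | no  x≢0 = true , sum≡0⇒≡ (*-cancelˡ (x + 1#) 0# x≢0 (trans x[x+1]≡0 (sym (zeroʳ x))))
    where
    x[x+1]≡0 : x * (x + 1#) ≡ 0#
    x[x+1]≡0 = trans (distribˡ x x 1#) (trans (cong₂ _+_ x²≡x (*-identityʳ x)) (x+x≡0 x))

  pow-+ : ∀ x a b → pow x (a N.+ b) ≡ pow x a * pow x b
  pow-+ x zero    b = sym (*-identityˡ _)
  pow-+ x (suc a) b = trans (cong (x *_) (pow-+ x a b)) (sym (*-assoc x _ _))

  pow-* : ∀ x y k → pow (x * y) k ≡ pow x k * pow y k
  pow-* x y zero    = sym (*-identityˡ 1#)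
  pow-* x y (suc k) = trans (cong (x * y *_) (pow-* x y k)) (*-interchange x y (pow x k) (pow y k))
    where
    *-interchange : ∀ a b c d → a * b * (c * d) ≡ a * c * (b * d)
    *-interchange = solve 4 (λ a b c d → a :* b :* (c :* d) := a :* c :* (b :* d)) refl
      where open 𝔽₂-Solver

  pow-1# : ∀ k → pow 1# k ≡ 1#
  pow-1# zero    = refl
  pow-1# (suc k) = trans (*-identityˡ _) (pow-1# k)

  pow-2^-suc : ∀ x j → pow x (2 ^ suc j) ≡ pow x (2 ^ j) ²
  pow-2^-suc x j = trans (pow-+ x (2 ^ j) (2 ^ j N.+ 0)) (cong (λ k → pow x (2 ^ j) * pow x k) (N.+-identityʳ (2 ^ j)))

  pow-2^-+ : ∀ j x y → pow (x + y) (2 ^ j) ≡ pow x (2 ^ j) + pow y (2 ^ j)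
  pow-2^-+ zero    x y = trans (*-identityʳ (x + y)) (sym (cong₂ _+_ (*-identityʳ x) (*-identityʳ y)))
  pow-2^-+ (suc j) x y = begin
    pow (x + y) (2 ^ suc j)                   ≡⟨ pow-2^-suc (x + y) j ⟩
    pow (x + y) (2 ^ j) ²                     ≡⟨ cong _² (pow-2^-+ j x y) ⟩
    (pow x (2 ^ j) + pow y (2 ^ j)) ²         ≡⟨ ²-+ _ _ ⟩
    pow x (2 ^ j) ² + pow y (2 ^ j) ²         ≡⟨ sym (cong₂ _+_ (pow-2^-suc x j) (pow-2^-suc y j)) ⟩
    pow x (2 ^ suc j) + pow y (2 ^ suc j)     ∎
    where open ≡-Reasoning

  *-commutativeMonoid : CommutativeMonoid _ _
  *-commutativeMonoid = record { isCommutativeMonoid = *-isCommutativeMonoid }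

  open ProductProperties *-commutativeMonoid
    using (sum-permute; ∑-distrib-+; sum-remove; sum-cong-≗) renaming (sum to ∏)

  ∏-nonzero : ∀ {M} (t : Fin M → K) → (∀ i → t i ≢ 0#) → ∏ t ≢ 0#
  ∏-nonzero {zero}  t _       = λ 1≡0 → 0≢1 (sym 1≡0)
  ∏-nonzero {suc M} t nonzero = *-nonzero (nonzero zero) (∏-nonzero (λ i → t (suc i)) (λ i → nonzero (suc i)))

  ∏-const : ∀ M x → ∏ {M} (λ _ → x) ≡ pow x M
  ∏-const zero    x = refl
  ∏-const (suc M) x = cong (x *_) (∏-const M x)

  nonzeroPart : K → K
  nonzeroPart y with y ≟ 0#
  ... | yes _ = 1#
  ... | no  _ = y

  nonzeroPart-nonzero : ∀ y → nonzeroPart y ≢ 0#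
  nonzeroPart-nonzero y with y ≟ 0#
  ... | yes _  = λ 1≡0 → 0≢1 (sym 1≡0)
  ... | no y≢0 = y≢0

  scaling : K → K → K
  scaling x y with y ≟ 0#
  ... | yes _ = 1#
  ... | no  _ = x

  nonzeroPart-* : ∀ {x} → x ≢ 0# → ∀ y → nonzeroPart (x * y) ≡ scaling x y * nonzeroPart y
  nonzeroPart-* {x} x≢0 y with y ≟ 0# | x * y ≟ 0#
  ... | yes _    | yes _     = sym (*-identityˡ 1#)
  ... | yes refl | no xy≢0   = ⊥-elim (xy≢0 (zeroʳ x))
  ... | no y≢0   | yes xy≡0  = ⊥-elim (*-nonzero x≢0 y≢0 xy≡0)
  ... | no _     | no _      = refl

  scaling-nonzero : ∀ x {y} → y ≢ 0# → scaling x y ≡ x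
  scaling-nonzero x {y} y≢0 with y ≟ 0#
  ... | yes y≡0 = ⊥-elim (y≢0 y≡0)
  ... | no  _   = refl

  scaling-zero : ∀ x → scaling x 0# ≡ 1#
  scaling-zero x with 0# ≟ 0#
  ... | yes _   = refl
  ... | no 0≢0  = ⊥-elim (0≢0 refl)

  -- Multiplication by x ≠ 0 permutes K, so the product P of the nonzero parts of all elements is also
  -- C · P, where C is the product of the scaling factors; C is x^(N-1) since only 0 has factor 1.
  module _ {M : ℕ} (enum : Fin (suc M) ↔ K) {x : K} (x≢0 : x ≢ 0#) where
    private
      module E = Inverse enum
      C = ∏ {suc M} (λ i → scaling x (E.to i))

    multiplyBy : Permutation (suc M) (suc M)
    multiplyBy = permutation (λ i → E.from (x * E.to i)) (λ i → E.from (x ⁻¹ * E.to i))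
      (λ i → trans (cong (λ y → E.from (x * y)) (E.strictlyInverseˡ _)) (trans (cong E.from (xx⁻¹ (E.to i))) (E.strictlyInverseʳ i)))
      (λ i → trans (cong (λ y → E.from (x ⁻¹ * y)) (E.strictlyInverseˡ _)) (trans (cong E.from (x⁻¹x (E.to i))) (E.strictlyInverseʳ i)))
      where
      x⁻¹x : ∀ y → x ⁻¹ * (x * y) ≡ y
      x⁻¹x y = trans (sym (*-assoc (x ⁻¹) x y)) (trans (cong (_* y) (inverseˡ x x≢0)) (*-identityˡ y))
      xx⁻¹ : ∀ y → x * (x ⁻¹ * y) ≡ y
      xx⁻¹ y = trans (sym (*-assoc x (x ⁻¹) y)) (trans (cong (_* y) (inverse x x≢0)) (*-identityˡ y))

    ∏-scaling≡1 : C ≡ 1#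
    ∏-scaling≡1 = *-cancelˡ C 1# (∏-nonzero nz (λ i → nonzeroPart-nonzero (E.to i))) (begin
      P * C
        ≡⟨ *-comm P C ⟩
      C * P
        ≡⟨ sym (∑-distrib-+ (λ i → scaling x (E.to i)) nz) ⟩
      ∏ {suc M} (λ i → scaling x (E.to i) * nz i)
        ≡⟨ sym (sum-cong-≗ {suc M} (λ i → nonzeroPart-* x≢0 (E.to i))) ⟩
      ∏ {suc M} (λ i → nonzeroPart (x * E.to i))
        ≡⟨ sym (sum-cong-≗ {suc M} (λ i → cong nonzeroPart (E.strictlyInverseˡ (x * E.to i)))) ⟩
      ∏ {suc M} (λ i → nz (E.from (x * E.to i)))
        ≡⟨ sym (sum-permute nz multiplyBy) ⟩
      P
        ≡⟨ sym (*-identityʳ P) ⟩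
      P * 1# ∎)
      where
      open ≡-Reasoning
      nz : Fin (suc M) → K
      nz i = nonzeroPart (E.to i)
      P = ∏ nz

    ∏-scaling≡pow : C ≡ pow x M
    ∏-scaling≡pow = begin
      C
        ≡⟨ sum-remove {i = i₀} (λ i → scaling x (E.to i)) ⟩
      scaling x (E.to i₀) * ∏ {M} others
        ≡⟨ cong (_* ∏ {M} others) (trans (cong (scaling x) (E.strictlyInverseˡ 0#)) (scaling-zero x)) ⟩
      1# * ∏ {M} others
        ≡⟨ *-identityˡ _ ⟩
      ∏ {M} others
        ≡⟨ sum-cong-≗ {M} (λ j → scaling-nonzero x (to-punchIn≢0 j)) ⟩
      ∏ {M} (λ _ → x)
        ≡⟨ ∏-const M x ⟩
      pow x M ∎
      where
      open ≡-Reasoning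
      i₀ = E.from 0#
      others : Fin M → K
      others j = scaling x (E.to (punchIn i₀ j))
      to-punchIn≢0 : ∀ j → E.to (punchIn i₀ j) ≢ 0#
      to-punchIn≢0 j eq = Fin.punchInᵢ≢i i₀ j (trans (sym (E.strictlyInverseʳ _)) (cong E.from eq))

  fermat-enum : ∀ {N} → Fin N ↔ K → ∀ x → pow x N ≡ x
  fermat-enum {zero}  enum x = ⊥-elim (Fin.¬Fin0 (Inverse.from enum x))
  fermat-enum {suc M} enum x with x ≟ 0#
  ... | yes refl = zeroˡ _
  ... | no  x≢0  = trans (cong (x *_) (trans (sym (∏-scaling≡pow enum x≢0)) (∏-scaling≡1 enum x≢0))) (*-identityʳ x)

  fermat : ∀ x → pow x (2 ^ n) ≡ x
  fermat = fermat-enum card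

  sumK-cong : ∀ m {f g : ℕ → K} → (∀ i → f i ≡ g i) → sumK m f ≡ sumK m g
  sumK-cong zero    f≗g = refl
  sumK-cong (suc m) f≗g = cong₂ _+_ (sumK-cong m f≗g) (f≗g m)

  sumK-+ : ∀ m (f g : ℕ → K) → sumK m (λ i → f i + g i) ≡ sumK m f + sumK m g
  sumK-+ zero    f g = sym (+-identityˡ 0#)
  sumK-+ (suc m) f g = trans (cong (_+ (f m + g m)) (sumK-+ m f g)) (+-interchange (sumK m f) (sumK m g) (f m) (g m))

  sumK-shift : ∀ m (f : ℕ → K) → sumK (suc m) f ≡ f 0 + sumK m (λ i → f (suc i))
  sumK-shift zero    f = trans (+-identityˡ (f 0)) (sym (+-identityʳ (f 0)))
  sumK-shift (suc m) f = trans (cong (_+ f (suc m)) (sumK-shift m f)) (+-assoc (f 0) _ _)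

  ²-sumK : ∀ m (f : ℕ → K) → sumK m f ² ≡ sumK m (λ i → f i ²)
  ²-sumK zero    f = zeroˡ 0#
  ²-sumK (suc m) f = trans (²-+ _ _) (cong (_+ f m ²) (²-sumK m f))

  Tr-+ : ∀ x y → Tr (x + y) ≡ Tr x + Tr y
  Tr-+ x y = trans (sumK-cong n (λ i → pow-2^-+ i x y)) (sumK-+ n _ _)

  Tr-0# : Tr 0# ≡ 0#
  Tr-0# = +-cancelˡ (Tr 0#) (trans (sym (Tr-+ 0# 0#)) (trans (cong Tr (+-identityˡ 0#)) (sym (+-identityʳ (Tr 0#)))))

  Tr-idempotent : ∀ x → Tr x ² ≡ Tr x
  Tr-idempotent x = +-cancelˡ x (begin
    x + Tr x ²
      ≡⟨ cong (x +_) (²-sumK n f) ⟩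
    x + sumK n (λ i → f i ²)
      ≡⟨ cong₂ _+_ (sym (*-identityʳ x)) (sumK-cong n (λ i → sym (pow-2^-suc x i))) ⟩
    f 0 + sumK n (λ i → f (suc i))
      ≡⟨ sym (sumK-shift n f) ⟩
    sumK (suc n) f
      ≡⟨ cong (Tr x +_) (fermat x) ⟩
    Tr x + x
      ≡⟨ +-comm (Tr x) x ⟩
    x + Tr x ∎)
    where
    open ≡-Reasoning
    f : ℕ → K
    f i = pow x (2 ^ i)

  Tr∈𝔽₂ : ∀ x → ∃ λ b → Tr x ≡ fromBool b
  Tr∈𝔽₂ x = idempotent⇒fromBool (Tr-idempotent x)

  Tr-² : ∀ x → Tr (x ²) ≡ Tr x
  Tr-² x = begin
    Tr (x ²)                             ≡⟨ sumK-cong n (λ i → pow-* x x (2 ^ i)) ⟩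
    sumK n (λ i → pow x (2 ^ i) ²)       ≡⟨ sym (²-sumK n _) ⟩
    Tr x ²                               ≡⟨ Tr-idempotent x ⟩
    Tr x                                 ∎
    where open ≡-Reasoning

  lincomb-⊕ : ∀ {m} (x y : Vec Bool m) (ω : Vec K m) → lincomb (x ⊕ y) ω ≡ lincomb x ω + lincomb y ω
  lincomb-⊕ []      []      []      = sym (+-identityˡ 0#)
  lincomb-⊕ (b ∷ x) (c ∷ y) (w ∷ ω) =
    trans (cong₂ _+_ (scal-xor b c w) (lincomb-⊕ x y ω)) (+-interchange (scal b w) (scal c w) (lincomb x ω) (lincomb y ω))

  lincomb-0ᵛ : ∀ {m} (ω : Vec K m) → lincomb 0ᵛ ω ≡ 0#
  lincomb-0ᵛ []      = refl
  lincomb-0ᵛ (w ∷ ω) = trans (+-identityˡ _) (lincomb-0ᵛ ω)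

  cubePolar : K → K → K
  cubePolar u v = Tr (u * v ²) + Tr (u ² * v)

  Tr-cube-+ : ∀ u v → Tr (pow (u + v) 3) ≡ Tr (pow u 3) + Tr (pow v 3) + cubePolar u v
  Tr-cube-+ u v = begin
    Tr (pow (u + v) 3)                                         ≡⟨ cong Tr (expand u v) ⟩
    Tr (pow u 3 + pow v 3 + (u * v ² + u ² * v))               ≡⟨ Tr-+ _ _ ⟩
    Tr (pow u 3 + pow v 3) + Tr (u * v ² + u ² * v)            ≡⟨ cong₂ _+_ (Tr-+ _ _) (Tr-+ _ _) ⟩
    Tr (pow u 3) + Tr (pow v 3) + cubePolar u v                ∎
    where
    open ≡-Reasoning
    expand : ∀ u v → pow (u + v) 3 ≡ pow u 3 + pow v 3 + (u * v ² + u ² * v)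
    expand = solve 2 (λ u v → (u :+ v) :* ((u :+ v) :* ((u :+ v) :* con true))
                            := u :* (u :* (u :* con true)) :+ v :* (v :* (v :* con true)) :+ (u :* (v :* v) :+ (u :* u) :* v)) refl
      where open 𝔽₂-Solver

  cubePolar-linearˡ : ∀ u u′ v → cubePolar (u + u′) v ≡ cubePolar u v + cubePolar u′ v
  cubePolar-linearˡ u u′ v = begin
    Tr ((u + u′) * v ²) + Tr ((u + u′) ² * v)
      ≡⟨ cong₂ _+_ (cong Tr (distribʳ (v ²) u u′)) (cong Tr (expand u u′ v)) ⟩
    Tr (u * v ² + u′ * v ²) + Tr (u ² * v + u′ ² * v)
      ≡⟨ cong₂ _+_ (Tr-+ _ _) (Tr-+ _ _) ⟩
    Tr (u * v ²) + Tr (u′ * v ²) + (Tr (u ² * v) + Tr (u′ ² * v))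
      ≡⟨ +-interchange _ _ _ _ ⟩
    cubePolar u v + cubePolar u′ v ∎
    where
    open ≡-Reasoning
    expand : ∀ u u′ v → (u + u′) ² * v ≡ u ² * v + u′ ² * v
    expand = solve 3 (λ u u′ v → (u :+ u′) :* (u :+ u′) :* v := u :* u :* v :+ u′ :* u′ :* v) refl
      where open 𝔽₂-Solver

  cubePolar-linearʳ : ∀ u v v′ → cubePolar u (v + v′) ≡ cubePolar u v + cubePolar u v′
  cubePolar-linearʳ u v v′ = begin
    Tr (u * (v + v′) ²) + Tr (u ² * (v + v′))
      ≡⟨ cong₂ _+_ (cong Tr (expand u v v′)) (cong Tr (distribˡ (u ²) v v′)) ⟩
    Tr (u * v ² + u * v′ ²) + Tr (u ² * v + u ² * v′)
      ≡⟨ cong₂ _+_ (Tr-+ _ _) (Tr-+ _ _) ⟩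
    Tr (u * v ²) + Tr (u * v′ ²) + (Tr (u ² * v) + Tr (u ² * v′))
      ≡⟨ +-interchange _ _ _ _ ⟩
    cubePolar u v + cubePolar u v′ ∎
    where
    open ≡-Reasoning
    expand : ∀ u v v′ → u * (v + v′) ² ≡ u * v ² + u * v′ ²
    expand = solve 3 (λ u v v′ → u :* ((v :+ v′) :* (v :+ v′)) := u :* (v :* v) :+ u :* (v′ :* v′)) refl
      where open 𝔽₂-Solver

  cubePolar-fromBool : ∀ u b → cubePolar u (fromBool b) ≡ 0#
  cubePolar-fromBool u false = begin
    Tr (u * (0# * 0#)) + Tr (u ² * 0#)
      ≡⟨ cong₂ (λ p q → Tr p + Tr q) (trans (cong (u *_) (zeroˡ 0#)) (zeroʳ u)) (zeroʳ (u ²)) ⟩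
    Tr 0# + Tr 0#
      ≡⟨ x+x≡0 (Tr 0#) ⟩
    0# ∎
    where open ≡-Reasoning
  cubePolar-fromBool u true = begin
    Tr (u * (1# * 1#)) + Tr (u ² * 1#)
      ≡⟨ cong₂ (λ p q → Tr p + Tr q) (trans (cong (u *_) (*-identityˡ 1#)) (*-identityʳ u)) (*-identityʳ (u ²)) ⟩
    Tr u + Tr (u ²)
      ≡⟨ cong (Tr u +_) (Tr-² u) ⟩
    Tr u + Tr u
      ≡⟨ x+x≡0 (Tr u) ⟩
    0# ∎
    where open ≡-Reasoning

module OddDegree {k : ℕ} (F : GF2^ (suc (k N.+ k))) where

  open GF2^ F
  open FiniteField F

  sumK-1#-even : ∀ j → sumK (j N.+ j) (λ _ → 1#) ≡ 0#
  sumK-1#-even zero    = refl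
  sumK-1#-even (suc j) = begin
    sumK (suc j N.+ suc j) (λ _ → 1#)              ≡⟨ cong (λ m → sumK (suc m) (λ _ → 1#)) (N.+-suc j j) ⟩
    sumK (j N.+ j) (λ _ → 1#) + 1# + 1#            ≡⟨ +-assoc _ 1# 1# ⟩
    sumK (j N.+ j) (λ _ → 1#) + (1# + 1#)          ≡⟨ cong₂ _+_ (sumK-1#-even j) (x+x≡0 1#) ⟩
    0# + 0#                                        ≡⟨ +-identityˡ 0# ⟩
    0#                                             ∎
    where open ≡-Reasoning

  Tr-1# : Tr 1# ≡ 1#
  Tr-1# = trans (sumK-cong (suc (k N.+ k)) (λ i → pow-1# (2 ^ i))) (trans (cong (_+ 1#) (sumK-1#-even k)) (+-identityˡ 1#))

  Tr-nondegenerate : ∀ d → (∀ z → Tr (d * z) ≡ 0#) → d ≡ 0#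
  Tr-nondegenerate d Tr[dz]≡0 with d ≟ 0#
  ... | yes d≡0 = d≡0
  ... | no  d≢0 = ⊥-elim (0≢1 (trans (sym (Tr[dz]≡0 (d ⁻¹))) (trans (cong Tr (inverse d d≢0)) Tr-1#)))

  √ : K → K
  √ z = pow z (2 ^ (k N.+ k))

  √-² : ∀ z → √ z ² ≡ z
  √-² z = trans (sym (pow-2^-suc z (k N.+ k))) (fermat z)

  ²²-fixed⇒²-fixed : ∀ {u} → u ² ² ≡ u → u ² ≡ u
  ²²-fixed⇒²-fixed {u} u⁴≡u = trans (cong _² (sym (even-power k))) (√-² u)
    where
    even-power : ∀ j → pow u (2 ^ (j N.+ j)) ≡ u
    even-power zero    = *-identityʳ u
    even-power (suc j) = begin
      pow u (2 ^ (suc j N.+ suc j))         ≡⟨ cong (λ m → pow u (2 ^ suc m)) (N.+-suc j j) ⟩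
      pow u (2 ^ suc (suc (j N.+ j)))       ≡⟨ pow-2^-suc u (suc (j N.+ j)) ⟩
      pow u (2 ^ suc (j N.+ j)) ²           ≡⟨ cong _² (pow-2^-suc u (j N.+ j)) ⟩
      pow u (2 ^ (j N.+ j)) ² ²             ≡⟨ cong (λ v → v ² ²) (even-power j) ⟩
      u ² ²                                 ≡⟨ u⁴≡u ⟩
      u                                     ∎
      where open ≡-Reasoning

  cubePolar-radical : ∀ u → (∀ w → cubePolar u w ≡ 0#) → ∃ λ b → u ≡ fromBool b
  cubePolar-radical u radical = idempotent⇒fromBool (²²-fixed⇒²-fixed (sym (sum≡0⇒≡ D≡0)))
    where
    D : K
    D = u + u ² ²
    Tr[Dw²] : ∀ w → Tr (D * w ²) ≡ cubePolar u w
    Tr[Dw²] w = begin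
      Tr ((u + u ² ²) * w ²)               ≡⟨ cong Tr (distribʳ (w ²) u (u ² ²)) ⟩
      Tr (u * w ² + u ² ² * w ²)           ≡⟨ Tr-+ _ _ ⟩
      Tr (u * w ²) + Tr (u ² ² * w ²)      ≡⟨ cong (λ t → Tr (u * w ²) + Tr t) (square (u ²) w) ⟩
      Tr (u * w ²) + Tr ((u ² * w) ²)      ≡⟨ cong (Tr (u * w ²) +_) (Tr-² (u ² * w)) ⟩
      cubePolar u w                        ∎
      where
      open ≡-Reasoning
      square : ∀ x y → x ² * y ² ≡ (x * y) ²
      square = solve 2 (λ x y → x :* x :* (y :* y) := x :* y :* (x :* y)) refl
        where open 𝔽₂-Solver
    D≡0 : D ≡ 0#
    D≡0 = Tr-nondegenerate D (λ z → trans (cong (λ v → Tr (D * v)) (sym (√-² z))) (trans (Tr[Dw²] (√ z)) (radical (√ z))))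

module Application {k : ℕ} (F : GF2^ (suc (k N.+ k))) where

  open GF2^ F
  open FiniteField F
  open OddDegree {k} F

  ImageCondition : K → Vec K (k N.+ k) → BoolFun (k N.+ k) → Set
  ImageCondition a ω Fh =
    ∀ x → ∃ λ c → lincomb x ω + (a ⁻¹) * Tr (pow a 3 * pow (lincomb x ω) 3) ≡ lincomb (Fh x ∷ c) (a ⁻¹ ∷ ω)

  module _ {a : K} (a≢0 : a ≢ 0#) {ω : Vec K (k N.+ k)} (basis : IsBasis (a ⁻¹ ∷ ω))
           {Fh : BoolFun (k N.+ k)} (image : ImageCondition a ω Fh) where

    U : Vec Bool (k N.+ k) → K
    U x = a * lincomb x ω

    U-⊕ : ∀ x y → U (x ⊕ y) ≡ U x + U y
    U-⊕ x y = trans (cong (a *_) (lincomb-⊕ x y ω)) (distribˡ a _ _)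

    U-0ᵛ : U 0ᵛ ≡ 0#
    U-0ᵛ = trans (cong (a *_) (lincomb-0ᵛ ω)) (zeroʳ a)

    basis-injective : ∀ {x y} → lincomb x (a ⁻¹ ∷ ω) ≡ lincomb y (a ⁻¹ ∷ ω) → x ≡ y
    basis-injective = proj₁ basis

    a*scal : ∀ b → a * scal b (a ⁻¹) ≡ fromBool b
    a*scal false = zeroʳ a
    a*scal true  = inverse a a≢0

    Fh-cube : ∀ x → fromBool (Fh x) ≡ Tr (pow (U x) 3)
    Fh-cube x = begin
      fromBool (Fh x)                          ≡⟨ cong fromBool (sym b≡Fh[x]) ⟩
      fromBool b                               ≡⟨ sym Tr[t]≡b ⟩
      Tr (pow a 3 * pow (lincomb x ω) 3)       ≡⟨ cong Tr (sym (pow-* a (lincomb x ω) 3)) ⟩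
      Tr (pow (U x) 3)                         ∎
      where
      open ≡-Reasoning
      b = proj₁ (Tr∈𝔽₂ (pow a 3 * pow (lincomb x ω) 3))
      Tr[t]≡b = proj₂ (Tr∈𝔽₂ (pow a 3 * pow (lincomb x ω) 3))
      same-point : lincomb (b ∷ x) (a ⁻¹ ∷ ω) ≡ lincomb (Fh x ∷ proj₁ (image x)) (a ⁻¹ ∷ ω)
      same-point = begin
        scal b (a ⁻¹) + lincomb x ω
          ≡⟨ +-comm _ (lincomb x ω) ⟩
        lincomb x ω + scal b (a ⁻¹)
          ≡⟨ cong (lincomb x ω +_) (trans (scal-fromBool b (a ⁻¹)) (*-comm (fromBool b) (a ⁻¹))) ⟩
        lincomb x ω + a ⁻¹ * fromBool b
          ≡⟨ cong (λ t → lincomb x ω + a ⁻¹ * t) (sym Tr[t]≡b) ⟩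
        lincomb x ω + a ⁻¹ * Tr (pow a 3 * pow (lincomb x ω) 3)
          ≡⟨ proj₂ (image x) ⟩
        lincomb (Fh x ∷ proj₁ (image x)) (a ⁻¹ ∷ ω) ∎
      b≡Fh[x] : b ≡ Fh x
      b≡Fh[x] = cong head (basis-injective {b ∷ x} {Fh x ∷ proj₁ (image x)} same-point)

    Fh-polar : ∀ x y → fromBool (polar Fh x y) ≡ cubePolar (U x) (U y)
    Fh-polar x y = begin
      fromBool (Fh (x ⊕ y) xor Fh x xor Fh y xor Fh 0ᵛ)
        ≡⟨ trans (fromBool-xor _ _) (cong (_ +_) (trans (fromBool-xor _ _) (cong (_ +_) (fromBool-xor _ _)))) ⟩
      fromBool (Fh (x ⊕ y)) + (fromBool (Fh x) + (fromBool (Fh y) + fromBool (Fh 0ᵛ)))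
        ≡⟨ cong₂ (λ p q → p + (fromBool (Fh x) + (fromBool (Fh y) + q))) (Fh-cube (x ⊕ y)) (Fh-cube 0ᵛ) ⟩
      C (U (x ⊕ y)) + (fromBool (Fh x) + (fromBool (Fh y) + C (U 0ᵛ)))
        ≡⟨ cong₂ (λ p q → C p + (fromBool (Fh x) + (fromBool (Fh y) + C q))) (U-⊕ x y) U-0ᵛ ⟩
      C (U x + U y) + (fromBool (Fh x) + (fromBool (Fh y) + C 0#))
        ≡⟨ cong₂ (λ p q → p + (q + (fromBool (Fh y) + C 0#))) (Tr-cube-+ (U x) (U y)) (Fh-cube x) ⟩
      C (U x) + C (U y) + cubePolar (U x) (U y) + (C (U x) + (fromBool (Fh y) + C 0#))
        ≡⟨ cong₂ (λ p q → C (U x) + C (U y) + cubePolar (U x) (U y) + (C (U x) + (p + q))) (Fh-cube y) C[0]≡0 ⟩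
      C (U x) + C (U y) + cubePolar (U x) (U y) + (C (U x) + (C (U y) + 0#))
        ≡⟨ cancel (C (U x)) (C (U y)) (cubePolar (U x) (U y)) ⟩
      cubePolar (U x) (U y) ∎
      where
      open ≡-Reasoning
      C : K → K
      C w = Tr (pow w 3)
      C[0]≡0 : C 0# ≡ 0#
      C[0]≡0 = trans (cong Tr (zeroˡ _)) Tr-0#
      cancel : ∀ p q r → p + q + r + (p + (q + 0#)) ≡ r
      cancel = solve 3 (λ p q r → p :+ q :+ r :+ (p :+ (q :+ con false)) := r) refl
        where open 𝔽₂-Solver

    Fh-quadratic : Quadratic Fh
    Fh-quadratic x y z = fromBool-injective (begin
      fromBool (polar Fh (x ⊕ y) z)                        ≡⟨ Fh-polar (x ⊕ y) z ⟩
      cubePolar (U (x ⊕ y)) (U z)                          ≡⟨ cong (λ u → cubePolar u (U z)) (U-⊕ x y) ⟩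
      cubePolar (U x + U y) (U z)                          ≡⟨ cubePolar-linearˡ (U x) (U y) (U z) ⟩
      cubePolar (U x) (U z) + cubePolar (U y) (U z)        ≡⟨ sym (cong₂ _+_ (Fh-polar x z) (Fh-polar y z)) ⟩
      fromBool (polar Fh x z) + fromBool (polar Fh y z)    ≡⟨ sym (fromBool-xor _ _) ⟩
      fromBool (polar Fh x z xor polar Fh y z)             ∎)
      where open ≡-Reasoning

    spanning : ∀ w → ∃₂ λ b c → w ≡ fromBool b + U c
    spanning w with proj₂ basis (a ⁻¹ * w)
    ... | b ∷ c , preimage = b , c , (begin
      w
        ≡⟨ sym (trans (sym (*-assoc a (a ⁻¹) w)) (trans (cong (_* w) (inverse a a≢0)) (*-identityˡ w))) ⟩
      a * (a ⁻¹ * w)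
        ≡⟨ cong (a *_) (sym (preimage refl)) ⟩
      a * (scal b (a ⁻¹) + lincomb c ω)
        ≡⟨ distribˡ a _ _ ⟩
      a * scal b (a ⁻¹) + U c
        ≡⟨ cong (_+ U c) (a*scal b) ⟩
      fromBool b + U c ∎)
      where open ≡-Reasoning

    Fh-nondegenerate : Nondegenerate Fh
    Fh-nondegenerate x orthogonal = cong tail (basis-injective {false ∷ x} {b ∷ 0ᵛ} same-point)
      where
      open ≡-Reasoning
      radical : ∀ w → cubePolar (U x) w ≡ 0#
      radical w with spanning w
      ... | b , c , refl = begin
        cubePolar (U x) (fromBool b + U c)
          ≡⟨ cubePolar-linearʳ (U x) (fromBool b) (U c) ⟩
        cubePolar (U x) (fromBool b) + cubePolar (U x) (U c)
          ≡⟨ cong₂ _+_ (cubePolar-fromBool (U x) b) (trans (sym (Fh-polar x c)) (cong fromBool (orthogonal c))) ⟩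
        0# + 0#
          ≡⟨ +-identityˡ 0# ⟩
        0# ∎
      b = proj₁ (cubePolar-radical (U x) radical)
      same-point : lincomb (false ∷ x) (a ⁻¹ ∷ ω) ≡ lincomb (b ∷ 0ᵛ) (a ⁻¹ ∷ ω)
      same-point = begin
        0# + lincomb x ω
          ≡⟨ +-identityˡ _ ⟩
        lincomb x ω
          ≡⟨ *-cancelˡ _ _ a≢0 (trans (proj₂ (cubePolar-radical (U x) radical)) (sym (a*scal b))) ⟩
        scal b (a ⁻¹)
          ≡⟨ sym (trans (cong (scal b (a ⁻¹) +_) (lincomb-0ᵛ ω)) (+-identityʳ _)) ⟩
        scal b (a ⁻¹) + lincomb 0ᵛ ω  ∎

mainTheorem8 : (k : ℕ) → 1 ≤ k → (F : GF2^ (N.suc (k N.+ k))) →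
    let open GF2^ F in
    (a : K) → a ≢ 0# →
    (ω : Vec K (k N.+ k)) → IsBasis (a ⁻¹ ∷ ω) →
    (Fh : BoolFun (k N.+ k)) →
    (∀ x → ∃ λ c → lincomb x ω + (a ⁻¹) * Tr (pow a 3 * pow (lincomb x ω) 3) ≡ lincomb (Fh x ∷ c) (a ⁻¹ ∷ ω)) →
    IsBent (k N.+ k) Fh × Σ Bool (λ ε → AffineEquivalent Fh (λ x → pairsQF x xor ε))
mainTheorem8 k 1≤k F a a≢0 ω basis Fh image =
  nondegenerate-bent-affineEquivalent Fh (Fh-quadratic a≢0 basis image) (Fh-nondegenerate a≢0 basis image) (N.≤-trans 1≤k (N.m≤m+n k k))
  where open Application {k} F
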